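{- Let $\mu,\nu$ be compositions with $n=\lvert\mu\rvert+\lvert\nu\rvert$, let $\kappa$ be a sorted stable configuration of $\widehat G_{\mu,\nu}$, and let $\sigma\in\mathfrak S_n$ be such that $0\le u_{\sigma^{ -1}(i)}<w_{\sigma^{ -1}(i)}(\sigma)$ for every $i\in[n]$. Then $\kappa$ is recurrent and $\sigma$ is the output word of the toppling algorithm applied to $\kappa$.
   Context: The graph $\widehat G_{\mu,\nu}$: vertex set $[n]$ partitioned into clique components $K_{\mu_1}=\{n,\dots,n-\mu_1+1\}$, $K_{\mu_2}=\{n-\mu_1,\dots,n-\mu_1-\mu_2+1\}$, etc., and independent components $I_{\nu_1}=\{1,\dots,\nu_1\}$, $I_{\nu_2}=\{\nu_1+1,\dots,\nu_1+\nu_2\}$, etc.; distinct vertices are adjacent iff they lie in different components or in the same clique component; plus a sink $0$ adjacent to all of $[n]$. Sandpile model: configurations are maps $\kappa:[n]\to\mathbb Z$; a non-sink vertex $v$ is stable if $\kappa(v)<\deg(v)$, unstable otherwise; toppling $v$ subtracts $\deg(v)$ at $v$ and adds $1$ at each neighbour. A stable $\kappa$ is recurrent if for some ordering of $[n]$, after toppling the sink and then the vertices of $[n]$ in this order, all intermediate configurations are non-negative on $[n]$. Sorted: weakly decreasing on each clique component and weakly increasing on each independent component (with respect to the integer order of the vertices). Toppling algorithm for a recurrent $\kappa$: topple the sink; then while some non-sink vertex is untoppled, for $i=n,\dots,1$: if $i$ is unstable, topple it and append $i$ to the output word. For a permutation $\sigma=\sigma(1)\cdots\sigma(n)$ (one-line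 notation), define $\widetilde\kappa$ by $\widetilde\kappa(v)=\kappa(v)$ on clique components and, listing $I_{\nu_s}$ decreasingly as $v^{(s)}_1>\cdots>v^{(s)}_{\nu_s}$, $\widetilde\kappa(v^{(s)}_j)=\kappa(v^{(s)}_j)+\nu_s-j$; set $u_{\sigma^{ -1}(i)}=\sigma^{ -1}(i)+\widetilde\kappa(i)-n$ for $i\in[n]$. Prepend $\sigma(0)=0$ and split $0\sigma(1)\cdots\sigma(n)$ into runs, its maximal consecutive decreasing substrings. For $i\in[n]$, $w_{\sigma^{ -1}(i)}(\sigma)$ is the number of entries in the same run as $i$ that are larger than $i$, plus the number of entries smaller than $i$ in the run immediately to the left of the run containing $i$. -}

module Defs where

open import Data.Bool using (Bool; true; false; if_then_else_; _∧_; _∨_; not; T)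
open import Data.Nat as ℕ using (ℕ; zero; suc; _∸_; _≡ᵇ_; _<ᵇ_)
open import Data.Nat.ListAction using (sum)
open import Data.Integer as ℤ using (ℤ; +_; _-_)
open import Data.List using (List; []; _∷_; _++_; map; upTo; downFrom; length; filter)
open import Data.Bool.ListAction using (all; any)
open import Data.List.Relation.Unary.All using (All)
open import Data.List.Relation.Binary.Permutation.Propositional using (_↭_)
open import Data.Product using (_×_; _,_; proj₁; proj₂; ∃; Σ)
open import Relation.Binary.PropositionalEquality using (_≡_)

Composition : List ℕ → Set
Composition c = All (λ k → 0 ℕ.< k) c

verts : ℕ → List ℕ
verts n = map suc (upTo n)

vertsDown : ℕ → List ℕ
vertsDown n = map suc (downFrom n)

countᵇ : (ℕ → Bool) → List ℕ → ℕ
countᵇ p xs = length (filter (λ x → Data.Bool.T? (p x)) xs)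
  where import Data.Bool

memᵇ : ℕ → List ℕ → Bool
memᵇ v xs = any (λ x → x ≡ᵇ v) xs

-- 1-based position of i in a word (σ⁻¹(i) when the word is σ)
posOf : List ℕ → ℕ → ℕ
posOf [] i = 0
posOf (x ∷ xs) i = if x ≡ᵇ i then 1 else suc (posOf xs i)

-- For a composition c = (c₁,c₂,…) cutting 0,1,2,… into consecutive blocks
-- of sizes c₁,c₂,…, blockInfo c p = (index of block containing p,
-- size of that block, offset of p from the start of that block).
blockInfo : List ℕ → ℕ → ℕ × ℕ × ℕ
blockInfo [] p = 0 , 0 , p
blockInfo (a ∷ as) p with p <ᵇ a
... | true = 0 , a , p
... | false with blockInfo as (p ∸ a)
...   | (i , s , o) = suc i , s , o

-- The graph \hat G_{μ,ν} on [n] ∪ {0}, n = |μ| + |ν|.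
-- Independent components I_{ν₁} = {1..ν₁}, I_{ν₂}, … occupy 1..|ν|;
-- clique components K_{μ₁} = {n,…,n-μ₁+1}, K_{μ₂}, … occupy |ν|+1..n.

module _ (μ ν : List ℕ) where

  size : ℕ
  size = sum μ ℕ.+ sum ν

  inVᵇ : ℕ → Bool
  inVᵇ v = (1 ℕ.≤ᵇ v) ∧ (v ℕ.≤ᵇ size)

  InV : ℕ → Set
  InV v = 1 ℕ.≤ v × v ℕ.≤ size

  isIndep : ℕ → Bool
  isIndep v = v ℕ.≤ᵇ sum ν

  blk : ℕ → ℕ × ℕ × ℕ
  blk v = if isIndep v then blockInfo ν (v ∸ 1) else blockInfo μ (size ∸ v)

  sameComp : ℕ → ℕ → Bool
  sameComp u v = (isIndep u Data.Bool.∧ isIndep v ∨ not (isIndep u) ∧ not (isIndep v))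
                 ∧ (proj₁ (blk u) ≡ᵇ proj₁ (blk v))
    where import Data.Bool

  adj : ℕ → ℕ → Bool
  adj u v = inVᵇ u ∧ inVᵇ v ∧ not (u ≡ᵇ v) ∧ (not (sameComp u v) ∨ not (isIndep u))

  -- degree of a non-sink vertex (the 1 counts the edge to the sink 0)
  deg : ℕ → ℕ
  deg v = suc (countᵇ (adj v) (verts size))

  Config : Set
  Config = ℕ → ℤ

  toppleSink : Config → Config
  toppleSink κ u = if inVᵇ u then κ u ℤ.+ ℤ.1ℤ else κ u

  topple : Config → ℕ → Config
  topple κ v u = if u ≡ᵇ v then κ u - + deg v
                 else if adj u v then κ u ℤ.+ ℤ.1ℤ else κ u

  Stable : Config → Set
  Stable κ = ∀ v → InV v → κ v ℤ.< + deg v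

  unstableᵇ : Config → ℕ → Bool
  unstableᵇ κ v = + deg v ℤ.≤ᵇ κ v

  NonNeg : Config → Set
  NonNeg κ = ∀ v → InV v → + 0 ℤ.≤ κ v

  NonNegRun : Config → List ℕ → Set
  NonNegRun κ [] = NonNeg κ
  NonNegRun κ (v ∷ vs) = NonNeg κ × NonNegRun (topple κ v) vs

  Recurrent : Config → Set
  Recurrent κ = Stable κ × Σ (List ℕ) (λ π → (π ↭ verts size) × NonNegRun (toppleSink κ) π)

  Sorted : Config → Set
  Sorted κ = ∀ u v → InV u → InV v → u ℕ.< v → sameComp u v ≡ true →
             (isIndep u ≡ false → κ v ℤ.≤ κ u) × (isIndep u ≡ true → κ u ℤ.≤ κ v)

  pass : Config → List ℕ → Config × List ℕ
  pass κ [] = κ , []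
  pass κ (i ∷ is) with unstableᵇ κ i
  ... | true = let r = pass (topple κ i) is in proj₁ r , i ∷ proj₂ r
  ... | false = pass κ is

  allToppledᵇ : List ℕ → Bool
  allToppledᵇ w = all (λ v → memᵇ v w) (verts size)

  -- big-step semantics of the while loop: Loop κ w r means that starting
  -- from configuration κ with output so far w, the loop terminates with output r
  data Loop : Config → List ℕ → List ℕ → Set where
    done : ∀ {κ w} → allToppledᵇ w ≡ true → Loop κ w w
    step : ∀ {κ w r} → allToppledᵇ w ≡ false →
           Loop (proj₁ (pass κ (vertsDown size))) (w ++ proj₂ (pass κ (vertsDown size))) r →
           Loop κ w r

  OutputWord : Config → List ℕ → Set
  OutputWord κ σ = Loop (toppleSink κ) [] σ

  -- κ̃ : on I_{ν_s} listed decreasingly v₁ > … > v_{ν_s}, κ̃(v_j) = κ(v_j) + ν_s - j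
  κtilde : Config → ℕ → ℤ
  κtilde κ v with isIndep v
  ... | false = κ v
  ... | true = let b = blk v
                   s = proj₁ (proj₂ b)
                   o = proj₂ (proj₂ b)
                   j = s ∸ o
               in κ v ℤ.+ (+ s - + j)

  -- u_{σ⁻¹(i)} = σ⁻¹(i) + κ̃(i) - n
  uStat : Config → List ℕ → ℕ → ℤ
  uStat κ σ i = (+ posOf σ i ℤ.+ κtilde κ i) - + size

-- Runs of 0σ(1)…σ(n): maximal consecutive decreasing substrings

addFront : ℕ → List (List ℕ) → List (List ℕ)
addFront x [] = (x ∷ []) ∷ []
addFront x ([] ∷ rs) = (x ∷ []) ∷ rs
addFront x ((y ∷ r) ∷ rs) = if y <ᵇ x then (x ∷ y ∷ r) ∷ rs else (x ∷ []) ∷ (y ∷ r) ∷ rs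

runs : List ℕ → List (List ℕ)
runs [] = []
runs (x ∷ xs) = addFront x (runs xs)

-- wAux prev rs i: scanning runs, prev = run immediately to the left
wAux : List ℕ → List (List ℕ) → ℕ → ℕ
wAux prev [] i = 0
wAux prev (r ∷ rs) i =
  if memᵇ i r then countᵇ (λ x → i <ᵇ x) r ℕ.+ countᵇ (λ x → x <ᵇ i) prev
  else wAux r rs i

wStat : List ℕ → ℕ → ℕ
wStat σ i = wAux [] (runs (0 ∷ σ)) i

module Submission where

-- Write σ = P r R, where P is the part of σ toppled so far. Then a vertex v holds
-- κ v + 1 + (number of neighbours of v in P) chips, minus deg v once v itself is in P.
-- The bound u ≥ 0 makes r unstable, while u < w, with w(y) bounded through the runs of 0σ by the
-- distance from r to y in σ, makes every untoppled vertex that the scan meets before r stable;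
-- toppled vertices remain stable because κ is. Within an independent component the vertices
-- topple from the top down, and sortedness of κ transfers stability downwards. So each pass
-- topples exactly the next vertices of σ, in order, as long as the scan n, …, 1 meets them in
-- that order: the output word is σ, and all configurations along σ are non-negative, so κ is
-- recurrent.

open import Defs
open import Data.Bool using (Bool; true; false; if_then_else_; _∧_; _∨_; not)
open import Data.Bool.Properties using (∧-zeroʳ; ∨-zeroʳ; ∨-identityʳ; T-≡)
open import Data.Bool.ListAction using (all)
open import Data.Nat as ℕ
  using (ℕ; zero; suc; _+_; _∸_; _≡ᵇ_; _<ᵇ_; _≤ᵇ_; _≤_; _<_; z≤n; s≤s)
open import Data.Nat.Properties
open import Data.Nat.ListAction using (sum)
open import Data.Integer as ℤ using (ℤ; +_; 1ℤ; 0ℤ)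
import Data.Integer.Properties as ℤ
open import Data.Integer.Tactic.RingSolver using (solve-∀)
import Data.Nat.Tactic.RingSolver as ℕ-Solver
open import Data.List using (List; []; _∷_; _++_; length; map; upTo; foldl)
open import Data.List.Properties
  using (++-assoc; ++-identityʳ; length-++; length-map; length-upTo; map-++; upTo-∷ʳ; foldl-∷ʳ; ∷-injectiveˡ; ∷-injectiveʳ)
open import Data.List.Relation.Unary.All as All using (All; []; _∷_)
open import Data.List.Relation.Unary.All.Properties using (++⁻)
open import Data.List.Relation.Binary.Permutation.Propositional
  using (_↭_; prep; swap; ↭-sym) renaming (refl to ↭-refl; trans to ↭-trans)
open import Data.List.Relation.Binary.Permutation.Propositional.Properties using (All-resp-↭; ↭-length)
open import Data.Product using (_×_; _,_; proj₁; proj₂; Σ-syntax)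
open import Data.Sum using (_⊎_; inj₁; inj₂; [_,_]′)
open import Data.Unit using (⊤; tt)
open import Data.Empty using (⊥; ⊥-elim)
open import Function using (case_of_; _∘_)
open import Function.Bundles using (Equivalence)
open import Relation.Binary.Definitions using (tri<; tri≈; tri>)
open import Relation.Binary.PropositionalEquality
open import Relation.Nullary using (¬_; yes; no)

≡ᵇ-true⁻ : ∀ {m n} → (m ≡ᵇ n) ≡ true → m ≡ n
≡ᵇ-true⁻ {m} {n} e = ≡ᵇ⇒≡ m n (Equivalence.from T-≡ e)

≡ᵇ-refl : ∀ m → (m ≡ᵇ m) ≡ true
≡ᵇ-refl m = Equivalence.to T-≡ (≡⇒≡ᵇ m m refl)

≡ᵇ-false : ∀ {m n} → m ≢ n → (m ≡ᵇ n) ≡ false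
≡ᵇ-false {m} {n} m≢n with m ≡ᵇ n in e
... | true = ⊥-elim (m≢n (≡ᵇ-true⁻ e))
... | false = refl

≡ᵇ-false⁻ : ∀ {m n} → (m ≡ᵇ n) ≡ false → m ≢ n
≡ᵇ-false⁻ {m} e refl = case trans (sym e) (≡ᵇ-refl m) of λ ()

≡ᵇ-sym : ∀ m n → (m ≡ᵇ n) ≡ (n ≡ᵇ m)
≡ᵇ-sym m n with m ≟ n
... | yes refl = refl
... | no m≢n = trans (≡ᵇ-false m≢n) (sym (≡ᵇ-false (m≢n ∘ sym)))

<ᵇ-true : ∀ {m n} → m < n → (m <ᵇ n) ≡ true
<ᵇ-true p = Equivalence.to T-≡ (<⇒<ᵇ p)

<ᵇ-true⁻ : ∀ {m n} → (m <ᵇ n) ≡ true → m < n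
<ᵇ-true⁻ {m} {n} e = <ᵇ⇒< m n (Equivalence.from T-≡ e)

<ᵇ-false : ∀ {m n} → n ≤ m → (m <ᵇ n) ≡ false
<ᵇ-false {m} {n} n≤m with m <ᵇ n in e
... | true = ⊥-elim (<⇒≱ (<ᵇ-true⁻ e) n≤m)
... | false = refl

<ᵇ-false⁻ : ∀ {m n} → (m <ᵇ n) ≡ false → n ≤ m
<ᵇ-false⁻ {m} {n} e with m <? n
... | yes m<n = case trans (sym (<ᵇ-true m<n)) e of λ ()
... | no m≮n = ≮⇒≥ m≮n

≤ᵇ-true : ∀ {m n} → m ≤ n → (m ≤ᵇ n) ≡ true
≤ᵇ-true p = Equivalence.to T-≡ (≤⇒≤ᵇ p)

≤ᵇ-true⁻ : ∀ {m n} → (m ≤ᵇ n) ≡ true → m ≤ n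
≤ᵇ-true⁻ {m} {n} e = ≤ᵇ⇒≤ m n (Equivalence.from T-≡ e)

≤ᵇ-false : ∀ {m n} → n < m → (m ≤ᵇ n) ≡ false
≤ᵇ-false {m} {n} n<m with m ≤ᵇ n in e
... | true = ⊥-elim (<⇒≱ n<m (≤ᵇ-true⁻ e))
... | false = refl

≤ᵇ-false⁻ : ∀ {m n} → (m ≤ᵇ n) ≡ false → n < m
≤ᵇ-false⁻ {m} {n} e with m ≤? n
... | yes m≤n = case trans (sym (≤ᵇ-true m≤n)) e of λ ()
... | no m≰n = ≰⇒> m≰n

∧-true⁻ : ∀ {b c} → (b ∧ c) ≡ true → b ≡ true × c ≡ true
∧-true⁻ {true} {true} _ = refl , refl

∧-true : ∀ {b c} → b ≡ true → c ≡ true → (b ∧ c) ≡ true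
∧-true refl refl = refl

≡true-ext : ∀ {b c} → (b ≡ true → c ≡ true) → (c ≡ true → b ≡ true) → b ≡ c
≡true-ext {true} f g = sym (f refl)
≡true-ext {false} {true} f g = g refl
≡true-ext {false} {false} f g = refl

module _ (p : ℕ → Bool) where

  countᵇ-++ : ∀ xs ys → countᵇ p (xs ++ ys) ≡ countᵇ p xs + countᵇ p ys
  countᵇ-++ [] ys = refl
  countᵇ-++ (x ∷ xs) ys with p x
  ... | true = cong suc (countᵇ-++ xs ys)
  ... | false = countᵇ-++ xs ys

  countᵇ-∷-cong : ∀ x {xs ys} → countᵇ p xs ≡ countᵇ p ys → countᵇ p (x ∷ xs) ≡ countᵇ p (x ∷ ys)
  countᵇ-∷-cong x e with p x
  ... | true = cong suc e
  ... | false = e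

  countᵇ-swap : ∀ x y xs → countᵇ p (x ∷ y ∷ xs) ≡ countᵇ p (y ∷ x ∷ xs)
  countᵇ-swap x y xs with p x in ex | p y in ey
  ... | true | true rewrite ex | ey = refl
  ... | true | false rewrite ex | ey = refl
  ... | false | true rewrite ex | ey = refl
  ... | false | false rewrite ex | ey = refl

  countᵇ-↭ : ∀ {xs ys} → xs ↭ ys → countᵇ p xs ≡ countᵇ p ys
  countᵇ-↭ ↭-refl = refl
  countᵇ-↭ (prep x r) = countᵇ-∷-cong x (countᵇ-↭ r)
  countᵇ-↭ (swap {xs} x y r) = trans (countᵇ-swap x y xs) (countᵇ-∷-cong y (countᵇ-∷-cong x (countᵇ-↭ r)))
  countᵇ-↭ (↭-trans r s) = trans (countᵇ-↭ r) (countᵇ-↭ s)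

  countᵇ-+-countᵇ-not : ∀ xs → countᵇ p xs + countᵇ (not ∘ p) xs ≡ length xs
  countᵇ-+-countᵇ-not [] = refl
  countᵇ-+-countᵇ-not (x ∷ xs) with p x
  ... | true = cong suc (countᵇ-+-countᵇ-not xs)
  ... | false = trans (+-suc _ _) (cong suc (countᵇ-+-countᵇ-not xs))

  All⇒countᵇ≡0 : ∀ {xs} → All (λ x → p x ≡ false) xs → countᵇ p xs ≡ 0
  All⇒countᵇ≡0 [] = refl
  All⇒countᵇ≡0 (e ∷ es) rewrite e = All⇒countᵇ≡0 es

  countᵇ-∧-split : ∀ (q : ℕ → Bool) xs →
    countᵇ p xs ≡ countᵇ (λ t → p t ∧ q t) xs + countᵇ (λ t → p t ∧ not (q t)) xs
  countᵇ-∧-split q [] = refl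
  countᵇ-∧-split q (x ∷ xs) with p x
  ... | false = countᵇ-∧-split q xs
  ... | true with q x
  ...   | true = cong suc (countᵇ-∧-split q xs)
  ...   | false = trans (cong suc (countᵇ-∧-split q xs)) (sym (+-suc _ _))

countᵇ-cong : ∀ {p q : ℕ → Bool} {xs} → All (λ x → p x ≡ q x) xs → countᵇ p xs ≡ countᵇ q xs
countᵇ-cong [] = refl
countᵇ-cong {q = q} {x ∷ _} (e ∷ es) rewrite e with q x
... | true = cong suc (countᵇ-cong es)
... | false = countᵇ-cong es

verts-suc : ∀ n → verts (suc n) ≡ verts n ++ suc n ∷ []
verts-suc n = trans (cong (map suc) (sym (upTo-∷ʳ n))) (map-++ suc (upTo n) (n ∷ []))

length-verts : ∀ n → length (verts n) ≡ n
length-verts n = trans (length-map suc (upTo n)) (length-upTo n)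

All-verts : ∀ n → All (λ t → 1 ≤ t × t ≤ n) (verts n)
All-verts zero = []
All-verts (suc n) rewrite verts-suc n = snoc (All.map (λ (a , b) → a , m≤n⇒m≤1+n b) (All-verts n))
  where
  snoc : ∀ {xs} → All (λ t → 1 ≤ t × t ≤ suc n) xs → All (λ t → 1 ≤ t × t ≤ suc n) (xs ++ suc n ∷ [])
  snoc [] = (s≤s z≤n , ≤-refl) ∷ []
  snoc (a ∷ as) = a ∷ snoc as

countᵇ-verts-suc : ∀ p n → countᵇ p (verts (suc n)) ≡ countᵇ p (verts n) + countᵇ p (suc n ∷ [])
countᵇ-verts-suc p n = trans (cong (countᵇ p) (verts-suc n)) (countᵇ-++ p (verts n) (suc n ∷ []))

countᵇ-verts-cong : ∀ {p q} n → (∀ t → 1 ≤ t → t ≤ n → p t ≡ q t) → countᵇ p (verts n) ≡ countᵇ q (verts n)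
countᵇ-verts-cong n h = countᵇ-cong (All.map (λ (a , b) → h _ a b) (All-verts n))

countᵇ-verts-interval : ∀ n a b → b ≤ n → countᵇ (λ t → (a <ᵇ t) ∧ (t ≤ᵇ b)) (verts n) ≡ b ∸ a
countᵇ-verts-interval zero a .zero z≤n = sym (0∸n≡0 a)
countᵇ-verts-interval (suc n) a b b≤1+n with b ≤? n
... | yes b≤n
  rewrite countᵇ-verts-suc (λ t → (a <ᵇ t) ∧ (t ≤ᵇ b)) n | countᵇ-verts-interval n a b b≤n
        | ≤ᵇ-false {suc n} {b} (s≤s b≤n) | ∧-zeroʳ (a <ᵇ suc n) = +-identityʳ _
... | no b≰n with ≤-antisym b≤1+n (≰⇒> b≰n)
... | refl
  rewrite countᵇ-verts-suc (λ t → (a <ᵇ t) ∧ (t ≤ᵇ suc n)) n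
        | countᵇ-verts-cong {q = λ t → (a <ᵇ t) ∧ (t ≤ᵇ n)} n
            (λ t _ t≤n → cong ((a <ᵇ t) ∧_) (trans (≤ᵇ-true (m≤n⇒m≤1+n t≤n)) (sym (≤ᵇ-true t≤n))))
        | countᵇ-verts-interval n a n ≤-refl | ≤ᵇ-true (≤-refl {suc n}) with a <ᵇ suc n in e
... | true = trans (+-comm (n ∸ a) 1) (sym (+-∸-assoc 1 {n} {a} (ℕ.s≤s⁻¹ (<ᵇ-true⁻ {a} e))))
... | false = trans (+-identityʳ (n ∸ a))
                (trans (m≤n⇒m∸n≡0 (≤-trans (n≤1+n n) 1+n≤a)) (sym (m≤n⇒m∸n≡0 1+n≤a)))
  where
  1+n≤a : suc n ≤ a
  1+n≤a = <ᵇ-false⁻ {a} e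

occurrences : ℕ → List ℕ → ℕ
occurrences v = countᵇ (_≡ᵇ v)

_∉_ : ℕ → List ℕ → Set
v ∉ xs = occurrences v xs ≡ 0

countᵇ-≡ᵇ-verts : ∀ n v → 1 ≤ v → v ≤ n → countᵇ (v ≡ᵇ_) (verts n) ≡ 1
countᵇ-≡ᵇ-verts n v 1≤v v≤n =
  trans (countᵇ-verts-cong n same) (trans (countᵇ-verts-interval n (v ∸ 1) v v≤n) v∸pred≡1)
  where
  v∸pred≡1 : v ∸ (v ∸ 1) ≡ 1
  v∸pred≡1 = trans (cong (_∸ (v ∸ 1)) (sym (m+[n∸m]≡n 1≤v))) (m+n∸n≡m 1 (v ∸ 1))
  same : ∀ t → 1 ≤ t → t ≤ n → (v ≡ᵇ t) ≡ ((v ∸ 1 <ᵇ t) ∧ (t ≤ᵇ v))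
  same t 1≤t _ = ≡true-ext ⇒ ⇐
    where
    ⇒ : (v ≡ᵇ t) ≡ true → ((v ∸ 1 <ᵇ t) ∧ (t ≤ᵇ v)) ≡ true
    ⇒ h rewrite ≡ᵇ-true⁻ {v} {t} h = ∧-true (<ᵇ-true (subst (t ∸ 1 <_) (m+[n∸m]≡n 1≤t) ≤-refl)) (≤ᵇ-true (≤-refl {t}))
    ⇐ : ((v ∸ 1 <ᵇ t) ∧ (t ≤ᵇ v)) ≡ true → (v ≡ᵇ t) ≡ true
    ⇐ h with ∧-true⁻ h
    ... | v-1<t , t≤v = subst (λ k → (v ≡ᵇ k) ≡ true)
          (≤-antisym (subst (_≤ t) (m+[n∸m]≡n 1≤v) (<ᵇ-true⁻ {v ∸ 1} v-1<t)) (≤ᵇ-true⁻ t≤v)) (≡ᵇ-refl v)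

occurrences-verts : ∀ n v → 1 ≤ v → v ≤ n → occurrences v (verts n) ≡ 1
occurrences-verts n v 1≤v v≤n = trans (countᵇ-verts-cong n (λ t _ _ → ≡ᵇ-sym t v)) (countᵇ-≡ᵇ-verts n v 1≤v v≤n)

∉-++ : ∀ {y} A B → y ∉ A → y ∉ B → y ∉ (A ++ B)
∉-++ {y} A B y∉A y∉B = trans (countᵇ-++ (_≡ᵇ y) A B) (cong₂ _+_ y∉A y∉B)

∉-++⁻ : ∀ {y} A B → y ∉ (A ++ B) → y ∉ A × y ∉ B
∉-++⁻ {y} A B h = let e = trans (sym (countᵇ-++ (_≡ᵇ y) A B)) h in m+n≡0⇒m≡0 _ e , m+n≡0⇒n≡0 (occurrences y A) e

∉-∷⁻ : ∀ {y x} xs → y ∉ (x ∷ xs) → x ≢ y × y ∉ xs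
∉-∷⁻ {y} {x} xs h with x ≡ᵇ y in e
... | false = ≡ᵇ-false⁻ e , h

∉-∷ : ∀ {y x} xs → x ≢ y → y ∉ xs → y ∉ (x ∷ xs)
∉-∷ {y} {x} xs x≢y y∉xs rewrite ≡ᵇ-false x≢y = y∉xs

occurrences-∷-self : ∀ x xs → occurrences x (x ∷ xs) ≡ suc (occurrences x xs)
occurrences-∷-self x xs rewrite ≡ᵇ-refl x = refl

∉⇒All≢ : ∀ {y} xs → y ∉ xs → All (_≢ y) xs
∉⇒All≢ [] _ = []
∉⇒All≢ {y} (x ∷ xs) h = let x≢y , y∉xs = ∉-∷⁻ {y} {x} xs h in x≢y ∷ ∉⇒All≢ xs y∉xs

∉⇒memᵇ : ∀ {y} xs → y ∉ xs → memᵇ y xs ≡ false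
∉⇒memᵇ [] _ = refl
∉⇒memᵇ {y} (x ∷ xs) h with ∉-∷⁻ {y} {x} xs h
... | x≢y , y∉xs rewrite ≡ᵇ-false x≢y = ∉⇒memᵇ xs y∉xs

memᵇ⇒∉ : ∀ {y} xs → memᵇ y xs ≡ false → y ∉ xs
memᵇ⇒∉ [] _ = refl
memᵇ⇒∉ {y} (x ∷ xs) h with x ≡ᵇ y
... | false = memᵇ⇒∉ xs h

∉-dec : ∀ y xs → y ∉ xs ⊎ ¬ y ∉ xs
∉-dec y xs with occurrences y xs
... | zero = inj₁ refl
... | suc _ = inj₂ (λ ())

split-at : ∀ y xs → ¬ y ∉ xs → Σ[ Y ∈ List ℕ ] Σ[ Z ∈ List ℕ ] xs ≡ Y ++ y ∷ Z × y ∉ Y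
split-at y [] h = ⊥-elim (h refl)
split-at y (x ∷ xs) h with x ≡ᵇ y in e
... | true = [] , xs , cong (_∷ xs) (≡ᵇ-true⁻ e) , refl
... | false with split-at y xs h
...   | Y , Z , eq , y∉Y = x ∷ Y , Z , cong (x ∷_) eq , ∉-∷ {y} {x} Y (≡ᵇ-false⁻ e) y∉Y

countᵇ≡0-if-∉ : ∀ {Q : ℕ → Set} q {xs} → All Q xs → (∀ t → Q t → q t ≡ true → t ∉ xs) → countᵇ q xs ≡ 0
countᵇ≡0-if-∉ q [] _ = refl
countᵇ≡0-if-∉ q {x ∷ xs} (Qx ∷ Qxs) h with q x in e
... | true = case trans (sym (occurrences-∷-self x xs)) (h x Qx e) of λ ()
... | false = countᵇ≡0-if-∉ q Qxs (λ t Qt qt → proj₂ (∉-∷⁻ {t} {x} xs (h t Qt qt)))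

all-true : ∀ (p : ℕ → Bool) {xs} → All (λ x → p x ≡ true) xs → all p xs ≡ true
all-true p [] = refl
all-true p (e ∷ es) rewrite e = all-true p es

all-true⁻ : ∀ (p : ℕ → Bool) xs {v} → all p xs ≡ true → ¬ v ∉ xs → p v ≡ true
all-true⁻ p [] _ v∈ = ⊥-elim (v∈ refl)
all-true⁻ p (x ∷ xs) {v} h v∈ with p x in e | x ≟ v
... | true | yes refl = e
... | true | no x≢v = all-true⁻ p xs h (λ v∉xs → v∈ (∉-∷ {v} {x} xs x≢v v∉xs))

-- In the cyclic scan n, n - 1, …, 1, n, … started right after a, the vertex c is met strictly before b.
ScanBetween : ℕ → ℕ → ℕ → Set
ScanBetween a b c = (b < c × c < a) ⊎ (a < b × (c < a ⊎ b < c))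

ScanBetween-raise : ∀ {a b y m} → ScanBetween a b y → y ≤ m → ¬ (y < a × a ≤ m) → ¬ (y < b × b ≤ m) →
  ScanBetween a b m
ScanBetween-raise {a} {m = m} (inj₁ (b<y , y<a)) y≤m no-a _ with m <? a
... | yes m<a = inj₁ (<-≤-trans b<y y≤m , m<a)
... | no m≮a = ⊥-elim (no-a (y<a , ≮⇒≥ m≮a))
ScanBetween-raise (inj₂ (a<b , inj₂ b<y)) y≤m _ _ = inj₂ (a<b , inj₂ (<-≤-trans b<y y≤m))
ScanBetween-raise {a} {m = m} (inj₂ (a<b , inj₁ y<a)) y≤m no-a _ with m <? a
... | yes m<a = inj₂ (a<b , inj₁ m<a)
... | no m≮a = ⊥-elim (no-a (y<a , ≮⇒≥ m≮a))

ScanBetween-suc : ∀ {a x} → a ≢ x → a ≢ suc x → ScanBetween a x (suc x)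
ScanBetween-suc {a} {x} a≢x a≢1+x with <-cmp a x
... | tri< a<x _ _ = inj₂ (a<x , inj₂ ≤-refl)
... | tri≈ _ a≡x _ = ⊥-elim (a≢x a≡x)
... | tri> _ _ x<a with m≤n⇒m<n∨m≡n x<a
...   | inj₁ 1+x<a = inj₁ (≤-refl , 1+x<a)
...   | inj₂ 1+x≡a = ⊥-elim (a≢1+x (sym 1+x≡a))

ScanBetween-≢ : ∀ {a b c} → ScanBetween a b c → c ≢ b
ScanBetween-≢ (inj₁ (b<c , _)) refl = <-irrefl refl b<c
ScanBetween-≢ (inj₂ (a<b , inj₁ c<a)) refl = <-asym a<b c<a
ScanBetween-≢ (inj₂ (_ , inj₂ b<c)) refl = <-irrefl refl b<c

ScanBetween-step : ∀ {a b c} → ScanBetween a b (suc c) → c ≡ b ⊎ ScanBetween a b c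
ScanBetween-step (inj₁ (b<1+c , 1+c<a)) with m≤n⇒m<n∨m≡n (ℕ.s≤s⁻¹ b<1+c)
... | inj₁ b<c = inj₂ (inj₁ (b<c , <-trans ≤-refl 1+c<a))
... | inj₂ b≡c = inj₁ (sym b≡c)
ScanBetween-step (inj₂ (a<b , inj₁ 1+c<a)) = inj₂ (inj₂ (a<b , inj₁ (<-trans ≤-refl 1+c<a)))
ScanBetween-step (inj₂ (a<b , inj₂ b<1+c)) with m≤n⇒m<n∨m≡n (ℕ.s≤s⁻¹ b<1+c)
... | inj₁ b<c = inj₂ (inj₂ (a<b , inj₂ b<c))
... | inj₂ b≡c = inj₁ (sym b≡c)

ScanBetween-restart : ∀ c {b} → b ≢ suc c → c ≡ b ⊎ ScanBetween (suc c) b c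
ScanBetween-restart c {b} b≢1+c with <-cmp b (suc c)
... | tri< b<1+c _ _ with m≤n⇒m<n∨m≡n (ℕ.s≤s⁻¹ b<1+c)
...   | inj₁ b<c = inj₂ (inj₁ (b<c , ≤-refl))
...   | inj₂ b≡c = inj₁ (sym b≡c)
ScanBetween-restart c b≢1+c | tri≈ _ b≡1+c _ = ⊥-elim (b≢1+c b≡1+c)
ScanBetween-restart c b≢1+c | tri> _ _ 1+c<b = inj₂ (inj₂ (1+c<b , inj₁ ≤-refl))

memᵇ-All : ∀ {P : ℕ → Set} y xs → memᵇ y xs ≡ true → All P xs → P y
memᵇ-All {P} y (x ∷ xs) m (p ∷ ps) with x ≡ᵇ y in e
... | true = subst P (≡ᵇ-true⁻ e) p
... | false = memᵇ-All y xs m ps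

runs-head : ∀ x xs → Σ[ r ∈ List ℕ ] Σ[ rs ∈ List (List ℕ) ]
  runs (x ∷ xs) ≡ (x ∷ r) ∷ rs × All (_< x) r
runs-head x [] = [] , [] , refl , []
runs-head x (h ∷ xs) with runs-head h xs
... | r , rs , eq , r<h rewrite eq with h <ᵇ x in e
... | true = h ∷ r , rs , refl , <ᵇ-true⁻ e ∷ All.map (λ t<h → <-trans t<h (<ᵇ-true⁻ e)) r<h
... | false = [] , (h ∷ r) ∷ rs , refl , []

wRuns : List ℕ → ℕ → ℕ
wRuns L y = wAux [] (runs L) y

countᵇ-∷-≤ : ∀ p x xs → countᵇ p (x ∷ xs) ≤ suc (countᵇ p xs)
countᵇ-∷-≤ p x xs with p x
... | true = ≤-refl
... | false = n≤1+n _

wAux-∷-prev-≤ : ∀ x prev rs y → wAux (x ∷ prev) rs y ≤ suc (wAux prev rs y)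
wAux-∷-prev-≤ x prev [] y = z≤n
wAux-∷-prev-≤ x prev (r ∷ rs) y with memᵇ y r
... | true = ≤-trans (+-monoʳ-≤ (countᵇ (y <ᵇ_) r) (countᵇ-∷-≤ (_<ᵇ y) x prev)) (≤-reflexive (+-suc _ _))
... | false = n≤1+n _

wAux-∷-prev-≡ : ∀ x prev rs y → y ≤ x → wAux (x ∷ prev) rs y ≡ wAux prev rs y
wAux-∷-prev-≡ x prev [] y _ = refl
wAux-∷-prev-≡ x prev (r ∷ rs) y y≤x with memᵇ y r
... | true rewrite <ᵇ-false {x} {y} y≤x = refl
... | false = refl

wRuns-∷-≤ : ∀ x L y → x ≢ y → wRuns (x ∷ L) y ≤ suc (wRuns L y)
wRuns-∷-≤ x L y x≢y with runs L
... | [] rewrite ≡ᵇ-false x≢y = z≤n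
... | [] ∷ rs rewrite ≡ᵇ-false x≢y = wAux-∷-prev-≤ x [] rs y
... | (h ∷ r) ∷ rs with h <ᵇ x
...   | true rewrite ≡ᵇ-false x≢y with memᵇ y (h ∷ r)
...     | true = +-monoˡ-≤ 0 (countᵇ-∷-≤ (y <ᵇ_) x (h ∷ r))
...     | false = wAux-∷-prev-≤ x (h ∷ r) rs y
wRuns-∷-≤ x L y x≢y | (h ∷ r) ∷ rs | false rewrite ≡ᵇ-false x≢y with memᵇ y (h ∷ r)
...     | true = ≤-trans (+-monoʳ-≤ _ (countᵇ-∷-≤ (_<ᵇ y) x [])) (≤-reflexive (+-suc _ 0))
...     | false = n≤1+n _

wRuns-head : ∀ y Z → wRuns (y ∷ Z) y ≡ 0
wRuns-head y Z with runs-head y Z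
... | r , rs , eq , r<y rewrite eq | ≡ᵇ-refl y | <ᵇ-false {y} {y} ≤-refl =
  trans (+-identityʳ _) (All⇒countᵇ≡0 (y <ᵇ_) (All.map (λ t<y → <ᵇ-false (<⇒≤ t<y)) r<y))

wRuns-≤-position : ∀ y Y Z → All (_≢ y) Y → wRuns (Y ++ y ∷ Z) y ≤ length Y
wRuns-≤-position y [] Z _ = ≤-reflexive (wRuns-head y Z)
wRuns-≤-position y (x ∷ Y) Z (x≢y ∷ Y≢y) =
  ≤-trans (wRuns-∷-≤ x (Y ++ y ∷ Z) y x≢y) (s≤s (wRuns-≤-position y Y Z Y≢y))

-- Prepending letters other than y only extends the first run or opens new ones; once y is
-- shielded, neither the run of y nor the run before it changes any more.
BelowHead : ℕ → List (List ℕ) → ℕ → Set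
BelowHead y [] h = ⊤
BelowHead y (r₂ ∷ _) h = memᵇ y r₂ ≡ true → y < h

Shielded : ℕ → List (List ℕ) → Set
Shielded y [] = ⊥
Shielded y ([] ∷ _) = ⊥
Shielded y ((h ∷ r) ∷ rs) = memᵇ y (h ∷ r) ≡ false × BelowHead y rs h

Shielded-addFront : ∀ x y rs → x ≢ y → Shielded y rs →
  Shielded y (addFront x rs) × wAux [] (addFront x rs) y ≡ wAux [] rs y
Shielded-addFront x y ((h ∷ r) ∷ rs) x≢y (y∉r , below) with h <ᵇ x in e
... | true rewrite ≡ᵇ-false x≢y | y∉r = (refl , below-x rs below) , w-same rs below
  where
  below-x : ∀ rs → BelowHead y rs h → BelowHead y rs x
  below-x [] _ = tt
  below-x (_ ∷ _) b y∈r₂ = <-trans (b y∈r₂) (<ᵇ-true⁻ e)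
  w-same : ∀ rs → BelowHead y rs h → wAux (x ∷ h ∷ r) rs y ≡ wAux (h ∷ r) rs y
  w-same [] _ = refl
  w-same (r₂ ∷ rs) b with memᵇ y r₂
  ... | true rewrite <ᵇ-false {x} {y} (<⇒≤ (<-trans (b refl) (<ᵇ-true⁻ e))) = refl
  ... | false = refl
... | false rewrite ≡ᵇ-false x≢y | y∉r = (refl , λ ()) , refl

Shielded-++ : ∀ y A L → All (_≢ y) A → Shielded y (runs L) →
  Shielded y (runs (A ++ L)) × wRuns (A ++ L) y ≡ wRuns L y
Shielded-++ y [] L _ sh = sh , refl
Shielded-++ y (x ∷ A) L (x≢y ∷ A≢y) sh =
  let sh′ , w≡ = Shielded-++ y A L A≢y sh
      sh″ , w≡′ = Shielded-addFront x y (runs (A ++ L)) x≢y sh′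
  in sh″ , trans w≡′ w≡

-- If the scan after a reaches y before b, then y is not in the run of a, and if it is in the
-- run of b then a < b and y < a, so the run [a] before it contributes nothing to w.
Shielded-scan : ∀ a b y L → ScanBetween a b y → a ≢ y → b ≢ y →
  Shielded y (runs (a ∷ b ∷ L)) × wRuns (a ∷ b ∷ L) y ≡ wRuns (b ∷ L) y
Shielded-scan a b y L scan a≢y b≢y with runs-head b L
... | r , rs , eq , r<b rewrite eq = cases (memᵇ y r) refl
  where
  Goal : Set
  Goal = Shielded y (addFront a ((b ∷ r) ∷ rs)) × wAux [] (addFront a ((b ∷ r) ∷ rs)) y ≡ wAux [] ((b ∷ r) ∷ rs) y
  y-in-run-of-b : memᵇ y r ≡ true → ScanBetween a b y → Goal
  y-in-run-of-b y∈r (inj₁ (b<y , _)) = ⊥-elim (<-asym (memᵇ-All y r y∈r r<b) b<y)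
  y-in-run-of-b y∈r (inj₂ (_ , inj₂ b<y)) = ⊥-elim (<-asym (memᵇ-All y r y∈r r<b) b<y)
  y-in-run-of-b y∈r (inj₂ (a<b , inj₁ y<a))
    rewrite <ᵇ-false {b} {a} (<⇒≤ a<b) | ≡ᵇ-false a≢y | ≡ᵇ-false b≢y | y∈r | <ᵇ-false {a} {y} (<⇒≤ y<a) =
      (refl , λ _ → y<a) , refl
  y-not-in-run-of-b : memᵇ y r ≡ false → ∀ c → (b <ᵇ a) ≡ c → Goal
  y-not-in-run-of-b y∉r true b<a rewrite b<a | ≡ᵇ-false a≢y | ≡ᵇ-false b≢y | y∉r =
    (refl , below rs) , wAux-∷-prev-≡ a (b ∷ r) rs y (<⇒≤ y<a)
    where
    y<a : y < a
    y<a = [ proj₂ , (λ (a<b , _) → ⊥-elim (<-asym a<b (<ᵇ-true⁻ b<a))) ]′ scan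
    below : ∀ rs → BelowHead y rs a
    below [] = tt
    below (_ ∷ _) _ = y<a
  y-not-in-run-of-b y∉r false b≮a rewrite b≮a | ≡ᵇ-false a≢y | ≡ᵇ-false b≢y | y∉r = (refl , λ ()) , refl
  cases : ∀ c → memᵇ y r ≡ c → Goal
  cases true y∈r = y-in-run-of-b y∈r scan
  cases false y∉r = y-not-in-run-of-b y∉r (b <ᵇ a) refl

wRuns-≤-after-scan : ∀ A a b Y y Z → All (_≢ y) A → a ≢ y → b ≢ y → All (_≢ y) Y →
  ScanBetween a b y → wRuns (A ++ a ∷ b ∷ Y ++ y ∷ Z) y ≤ suc (length Y)
wRuns-≤-after-scan A a b Y y Z A≢y a≢y b≢y Y≢y scan =
  let sh , w≡ = Shielded-scan a b y (Y ++ y ∷ Z) scan a≢y b≢y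
      _ , w≡′ = Shielded-++ y A (a ∷ b ∷ Y ++ y ∷ Z) A≢y sh
  in ≤-trans (≤-reflexive (trans w≡′ w≡)) (wRuns-≤-position y (b ∷ Y) Z (b≢y ∷ Y≢y))

blockInfo-< : ∀ a as p → p < a → blockInfo (a ∷ as) p ≡ (0 , a , p)
blockInfo-< a as p p<a rewrite <ᵇ-true p<a = refl

blockInfo-≥ : ∀ a as p → a ≤ p →
  blockInfo (a ∷ as) p ≡ (suc (proj₁ (blockInfo as (p ∸ a))) , proj₂ (blockInfo as (p ∸ a)))
blockInfo-≥ a as p a≤p rewrite <ᵇ-false {p} {a} a≤p = refl

record Block (c : List ℕ) (p : ℕ) : Set where
  field
    index width offset start : ℕ
    blockInfo≡ : blockInfo c p ≡ (index , width , offset)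
    start+offset : start + offset ≡ p
    offset<width : offset < width
    end≤sum : start + width ≤ sum c
    index⁻¹ : ∀ q → q < sum c → proj₁ (blockInfo c q) ≡ index → start ≤ q × q < start + width
    blockInfo-inside : ∀ d → d < width → blockInfo c (start + d) ≡ (index , width , d)

block : ∀ c p → p < sum c → Block c p
block (a ∷ as) p p<sum with p <? a
... | yes p<a = record
  { index = 0 ; width = a ; offset = p ; start = 0
  ; blockInfo≡ = blockInfo-< a as p p<a
  ; start+offset = refl
  ; offset<width = p<a
  ; end≤sum = m≤m+n a (sum as)
  ; index⁻¹ = λ q _ idx → z≤n , first-block q idx
  ; blockInfo-inside = λ d d<a → blockInfo-< a as d d<a }
  where
  first-block : ∀ q → proj₁ (blockInfo (a ∷ as) q) ≡ 0 → q < a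
  first-block q idx with q <? a
  ... | yes q<a = q<a
  ... | no q≮a = case trans (sym (cong proj₁ (blockInfo-≥ a as q (≮⇒≥ q≮a)))) idx of λ ()
... | no p≮a = record
  { index = suc index ; width = width ; offset = offset ; start = a + start
  ; blockInfo≡ = trans (blockInfo-≥ a as p a≤p) (cong (λ (i , so) → suc i , so) blockInfo≡)
  ; start+offset = trans (+-assoc a start offset) (trans (cong (λ k → a + k) start+offset) (m+[n∸m]≡n a≤p))
  ; offset<width = offset<width
  ; end≤sum = ≤-trans (≤-reflexive (+-assoc a start width)) (+-monoʳ-≤ a end≤sum)
  ; index⁻¹ = later-block
  ; blockInfo-inside = inside
  }
  where
  a≤p : a ≤ p
  a≤p = ≮⇒≥ p≮a
  shift< : ∀ q → q < a + sum as → a ≤ q → q ∸ a < sum as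
  shift< q q< a≤q = subst (q ∸ a <_) (m+n∸m≡n a (sum as)) (∸-monoˡ-< q< a≤q)
  B : Block as (p ∸ a)
  B = block as (p ∸ a) (shift< p p<sum a≤p)
  open Block B
  later-block : ∀ q → q < a + sum as → proj₁ (blockInfo (a ∷ as) q) ≡ suc index →
    a + start ≤ q × q < a + start + width
  later-block q q< idx with q <? a
  ... | yes q<a = case trans (sym (cong proj₁ (blockInfo-< a as q q<a))) idx of λ ()
  ... | no q≮a with index⁻¹ (q ∸ a) (shift< q q< (≮⇒≥ q≮a))
                      (suc-injective (trans (sym (cong proj₁ (blockInfo-≥ a as q (≮⇒≥ q≮a)))) idx))
  ... | lo , hi = subst (a + start ≤_) (m+[n∸m]≡n (≮⇒≥ q≮a)) (+-monoʳ-≤ a lo)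
                , subst (_< a + start + width) (m+[n∸m]≡n (≮⇒≥ q≮a))
                    (subst (a + (q ∸ a) <_) (sym (+-assoc a start width)) (+-monoʳ-< a hi))
  inside : ∀ d → d < width → blockInfo (a ∷ as) (a + start + d) ≡ (suc index , width , d)
  inside d d<width =
    trans (blockInfo-≥ a as (a + start + d) (≤-trans (m≤m+n a _) (≤-reflexive (sym (+-assoc a start d)))))
          (cong (λ (i , so) → suc i , so)
            (trans (cong (blockInfo as) (trans (cong (_∸ a) (+-assoc a start d)) (m+n∸m≡n a _)))
                   (blockInfo-inside d d<width)))

module Graph (μ ν : List ℕ) where

  n : ℕ
  n = size μ ν

  sum-ν≤n : sum ν ≤ n
  sum-ν≤n = m≤n+m (sum ν) (sum μ)

  inVᵇ-true : ∀ {v} → InV μ ν v → inVᵇ μ ν v ≡ true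
  inVᵇ-true (1≤v , v≤n) = ∧-true (≤ᵇ-true 1≤v) (≤ᵇ-true v≤n)

  -- An independent vertex v lies in the component {start v + 1, …, top v} of width v vertices,
  -- at position offset v (counting from 0) within it.
  index width offset start top : ℕ → ℕ
  index v = proj₁ (blk μ ν v)
  width v = proj₁ (proj₂ (blk μ ν v))
  offset v = proj₂ (proj₂ (blk μ ν v))
  start v = (v ∸ 1) ∸ offset v
  top v = start v + width v

  record SameComponent (v t : ℕ) : Set where
    field
      indep : isIndep μ ν t ≡ true
      start≡ : start t ≡ start v
      width≡ : width t ≡ width v
      offset≡ : offset t ≡ t ∸ 1 ∸ start v

    top≡ : top t ≡ top v
    top≡ = cong₂ _+_ start≡ width≡

  record IndepComponent (v : ℕ) : Set where
    field
      offset<width : offset v < width v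
      start<v : start v < v
      v≤top : v ≤ top v
      start+offset : start v + offset v ≡ v ∸ 1
      top≤sum : top v ≤ sum ν
      sameComp≡ : ∀ t → 1 ≤ t → sameComp μ ν v t ≡ ((start v <ᵇ t) ∧ (t ≤ᵇ top v))
      member : ∀ t → start v < t → t ≤ top v → SameComponent v t

  blk-indep : ∀ v → isIndep μ ν v ≡ true → blk μ ν v ≡ blockInfo ν (v ∸ 1)
  blk-indep v e rewrite e = refl

  private
    1+pred : ∀ {v} → 1 ≤ v → suc (v ∸ 1) ≡ v
    1+pred = m+[n∸m]≡n

    sameComp-indep : ∀ v t → isIndep μ ν v ≡ true → sameComp μ ν v t ≡ ((isIndep μ ν t ∨ false) ∧ (index v ≡ᵇ index t))
    sameComp-indep v t e rewrite e = refl

  -- The component of an independent vertex v is read off the block of ν containing v - 1.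
  private
    module BlockOf {v} (1≤v : 1 ≤ v) (v-indep : isIndep μ ν v ≡ true) where
      v-1<sum : v ∸ 1 < sum ν
      v-1<sum = subst (_≤ sum ν) (sym (1+pred 1≤v)) (≤ᵇ-true⁻ v-indep)
      module B = Block (block ν (v ∸ 1) v-1<sum)
      blk≡ : blk μ ν v ≡ (B.index , B.width , B.offset)
      blk≡ = trans (blk-indep v v-indep) B.blockInfo≡
      offset≡ : offset v ≡ B.offset
      offset≡ = cong (proj₂ ∘ proj₂) blk≡
      width≡ : width v ≡ B.width
      width≡ = cong (proj₁ ∘ proj₂) blk≡
      index≡ : index v ≡ B.index
      index≡ = cong proj₁ blk≡
      start≡ : start v ≡ B.start
      start≡ = trans (cong (v ∸ 1 ∸_) offset≡) (trans (cong (_∸ B.offset) (sym B.start+offset)) (m+n∸n≡m B.start B.offset))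
      start+shift : ∀ t → B.start < t → B.start + (t ∸ 1 ∸ B.start) ≡ t ∸ 1
      start+shift t s<t = m+[n∸m]≡n (ℕ.s≤s⁻¹ (subst (B.start <_) (sym (1+pred (≤-trans (s≤s z≤n) s<t))) s<t))
      inside : ∀ t → B.start < t → t ≤ B.start + B.width → blockInfo ν (t ∸ 1) ≡ (B.index , B.width , t ∸ 1 ∸ B.start)
      inside t s<t t≤ = trans (cong (blockInfo ν) (sym (start+shift t s<t))) (B.blockInfo-inside (t ∸ 1 ∸ B.start)
        (+-cancelˡ-< B.start _ _ (subst (_< B.start + B.width) (sym (start+shift t s<t))
          (subst (_≤ B.start + B.width) (sym (1+pred (≤-trans (s≤s z≤n) s<t))) t≤))))
      member-block : ∀ t → B.start < t → t ≤ B.start + B.width → SameComponent v t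
      member-block t s<t t≤ = record
        { indep = t-indep
        ; start≡ = trans (cong (t ∸ 1 ∸_) offset-t)
            (trans (cong (_∸ (t ∸ 1 ∸ B.start)) (sym (start+shift t s<t))) (trans (m+n∸n≡m B.start (t ∸ 1 ∸ B.start)) (sym start≡)))
        ; width≡ = trans (cong (proj₁ ∘ proj₂) blk-t) (sym width≡)
        ; offset≡ = trans offset-t (cong (t ∸ 1 ∸_) (sym start≡))
        }
        where
        t-indep : isIndep μ ν t ≡ true
        t-indep = ≤ᵇ-true (≤-trans t≤ B.end≤sum)
        blk-t : blk μ ν t ≡ (B.index , B.width , t ∸ 1 ∸ B.start)
        blk-t = trans (blk-indep t t-indep) (inside t s<t t≤)
        offset-t : offset t ≡ t ∸ 1 ∸ B.start
        offset-t = cong (proj₂ ∘ proj₂) blk-t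
      sameComp≡-block : ∀ t → 1 ≤ t → sameComp μ ν v t ≡ ((B.start <ᵇ t) ∧ (t ≤ᵇ B.start + B.width))
      sameComp≡-block t 1≤t = trans (sameComp-indep v t v-indep) (by-indep-t (isIndep μ ν t) refl)
        where
        by-indep-t : ∀ b → isIndep μ ν t ≡ b →
          ((b ∨ false) ∧ (index v ≡ᵇ index t)) ≡ ((B.start <ᵇ t) ∧ (t ≤ᵇ B.start + B.width))
        by-indep-t false t-clique =
          sym (trans (cong ((B.start <ᵇ t) ∧_) (≤ᵇ-false (<-≤-trans (s≤s B.end≤sum) (≤ᵇ-false⁻ {t} t-clique)))) (∧-zeroʳ _))
        by-indep-t true t-indep rewrite index≡ | blk-indep t t-indep = ≡true-ext same⇒between between⇒same
          where
          same⇒between : (B.index ≡ᵇ proj₁ (blockInfo ν (t ∸ 1))) ≡ true → ((B.start <ᵇ t) ∧ (t ≤ᵇ B.start + B.width)) ≡ true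
          same⇒between h with B.index⁻¹ (t ∸ 1) (subst (_≤ sum ν) (sym (1+pred 1≤t)) (≤ᵇ-true⁻ t-indep)) (sym (≡ᵇ-true⁻ h))
          ... | lo , hi = ∧-true (<ᵇ-true (subst (B.start <_) (1+pred 1≤t) (s≤s lo)))
                                 (≤ᵇ-true (subst (_≤ B.start + B.width) (1+pred 1≤t) hi))
          between⇒same : ((B.start <ᵇ t) ∧ (t ≤ᵇ B.start + B.width)) ≡ true → (B.index ≡ᵇ proj₁ (blockInfo ν (t ∸ 1))) ≡ true
          between⇒same h with ∧-true⁻ h
          ... | s<t , t≤ rewrite inside t (<ᵇ-true⁻ s<t) (≤ᵇ-true⁻ t≤) = ≡ᵇ-refl B.index

  indepComponent : ∀ v → 1 ≤ v → isIndep μ ν v ≡ true → IndepComponent v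
  indepComponent v 1≤v v-indep = record
    { offset<width = subst₂ _<_ (sym offset≡) (sym width≡) B.offset<width
    ; start<v = subst (_< v) (sym start≡) (subst (B.start <_) (1+pred 1≤v) (s≤s (subst (B.start ≤_) B.start+offset (m≤m+n B.start B.offset))))
    ; v≤top = subst₂ (λ s w → v ≤ s + w) (sym start≡) (sym width≡)
                (subst (_≤ B.start + B.width) (1+pred 1≤v)
                  (subst (λ k → suc k ≤ B.start + B.width) B.start+offset (+-monoʳ-< B.start B.offset<width)))
    ; start+offset = trans (cong₂ _+_ start≡ offset≡) B.start+offset
    ; top≤sum = subst₂ (λ s w → s + w ≤ sum ν) (sym start≡) (sym width≡) B.end≤sum
    ; sameComp≡ = λ t 1≤t → subst₂ (λ s w → sameComp μ ν v t ≡ ((s <ᵇ t) ∧ (t ≤ᵇ s + w)))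
                                (sym start≡) (sym width≡) (sameComp≡-block t 1≤t)
    ; member = λ t s<t t≤top → member-block t (subst (_< t) start≡ s<t) (subst₂ (λ s w → t ≤ s + w) start≡ width≡ t≤top)
    }
    where open BlockOf 1≤v v-indep

  module _ {v} (1≤v : 1 ≤ v) (v-indep : isIndep μ ν v ≡ true) where
    open IndepComponent (indepComponent v 1≤v v-indep)

    sameComp-self : sameComp μ ν v v ≡ true
    sameComp-self = trans (sameComp≡ v 1≤v) (∧-true (<ᵇ-true start<v) (≤ᵇ-true v≤top))

    sameComp⇒between : ∀ {t} → 1 ≤ t → sameComp μ ν v t ≡ true → start v < t × t ≤ top v
    sameComp⇒between {t} 1≤t h with ∧-true⁻ (trans (sym (sameComp≡ t 1≤t)) h)
    ... | s<t , t≤top = <ᵇ-true⁻ s<t , ≤ᵇ-true⁻ t≤top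

    between⇒sameComp : ∀ {t} → start v < t → t ≤ top v → sameComp μ ν v t ≡ true
    between⇒sameComp {t} s<t t≤top = trans (sameComp≡ t (≤-trans (s≤s z≤n) s<t)) (∧-true (<ᵇ-true s<t) (≤ᵇ-true t≤top))

    sameComp-member : ∀ {m} → start v < m → m ≤ top v → ∀ t → 1 ≤ t → sameComp μ ν m t ≡ sameComp μ ν v t
    sameComp-member {m} s<m m≤top t 1≤t =
      trans (IndepComponent.sameComp≡ (indepComponent m (≤-trans (s≤s z≤n) s<m) M.indep) t 1≤t)
            (trans (cong₂ (λ s e → (s <ᵇ t) ∧ (t ≤ᵇ e)) M.start≡ M.top≡) (sym (sameComp≡ t 1≤t)))
      where module M = SameComponent (member m s<m m≤top)

    countᵇ-sameComp : countᵇ (sameComp μ ν v) (verts n) ≡ width v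
    countᵇ-sameComp = trans (countᵇ-verts-cong n (λ t 1≤t _ → sameComp≡ t 1≤t))
      (trans (countᵇ-verts-interval n (start v) (top v) (≤-trans top≤sum sum-ν≤n)) (m+n∸m≡n (start v) (width v)))

    countᵇ-sameComp-above : countᵇ (λ t → sameComp μ ν v t ∧ (v <ᵇ t)) (verts n) ≡ top v ∸ v
    countᵇ-sameComp-above = trans (countᵇ-verts-cong n above) (countᵇ-verts-interval n v (top v) (≤-trans top≤sum sum-ν≤n))
      where
      above : ∀ t → 1 ≤ t → t ≤ n → (sameComp μ ν v t ∧ (v <ᵇ t)) ≡ ((v <ᵇ t) ∧ (t ≤ᵇ top v))
      above t 1≤t _ rewrite sameComp≡ t 1≤t = ≡true-ext ⇒ ⇐
        where
        ⇒ : (((start v <ᵇ t) ∧ (t ≤ᵇ top v)) ∧ (v <ᵇ t)) ≡ true → ((v <ᵇ t) ∧ (t ≤ᵇ top v)) ≡ true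
        ⇒ h with ∧-true⁻ {(start v <ᵇ t) ∧ (t ≤ᵇ top v)} h
        ... | h₁ , v<t = ∧-true v<t (proj₂ (∧-true⁻ {start v <ᵇ t} h₁))
        ⇐ : ((v <ᵇ t) ∧ (t ≤ᵇ top v)) ≡ true → (((start v <ᵇ t) ∧ (t ≤ᵇ top v)) ∧ (v <ᵇ t)) ≡ true
        ⇐ h with ∧-true⁻ {v <ᵇ t} h
        ... | v<t , t≤top = ∧-true (∧-true (<ᵇ-true {start v} {t} (<-trans start<v (<ᵇ-true⁻ {v} v<t))) t≤top) v<t

    above+offset : suc ((top v ∸ v) + offset v) ≡ width v
    above+offset = +-cancelʳ-≡ (start v) _ _ (begin
      suc ((top v ∸ v) + offset v) + start v  ≡⟨ rearrange (top v ∸ v) (offset v) (start v) ⟩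
      (top v ∸ v) + suc (start v + offset v)  ≡⟨ cong (λ k → (top v ∸ v) + suc k) start+offset ⟩
      (top v ∸ v) + suc (v ∸ 1)               ≡⟨ cong (λ k → (top v ∸ v) + k) (m+[n∸m]≡n 1≤v) ⟩
      (top v ∸ v) + v                         ≡⟨ m∸n+n≡m v≤top ⟩
      start v + width v                       ≡⟨ +-comm (start v) (width v) ⟩
      width v + start v                       ∎)
      where
      open ≡-Reasoning
      rearrange : ∀ a o s → suc (a + o) + s ≡ a + suc (s + o)
      rearrange = ℕ-Solver.solve-∀

  private
    adj-inV : ∀ {v t} → InV μ ν v → InV μ ν t →
      adj μ ν v t ≡ (not (v ≡ᵇ t) ∧ (not (sameComp μ ν v t) ∨ not (isIndep μ ν v)))
    adj-inV v∈ t∈ rewrite inVᵇ-true v∈ | inVᵇ-true t∈ = refl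

  adj-indep : ∀ {v t} → InV μ ν v → InV μ ν t → isIndep μ ν v ≡ true → adj μ ν v t ≡ not (sameComp μ ν v t)
  adj-indep {v} {t} v∈ t∈ v-indep = trans (adj-inV v∈ t∈) (by-equality (v ≡ᵇ t) refl)
    where
    by-equality : ∀ b → (v ≡ᵇ t) ≡ b →
      (not b ∧ (not (sameComp μ ν v t) ∨ not (isIndep μ ν v))) ≡ not (sameComp μ ν v t)
    by-equality true e =
      sym (cong not (trans (cong (sameComp μ ν v) (sym (≡ᵇ-true⁻ {v} {t} e))) (sameComp-self {v} (proj₁ v∈) v-indep)))
    by-equality false _ = trans (cong (λ b → not (sameComp μ ν v t) ∨ not b) v-indep) (∨-identityʳ _)

  adj-clique : ∀ {v t} → InV μ ν v → InV μ ν t → isIndep μ ν v ≡ false → adj μ ν v t ≡ not (v ≡ᵇ t)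
  adj-clique {v} {t} v∈ t∈ v-clique rewrite adj-inV v∈ t∈ | v-clique with v ≡ᵇ t
  ... | true = refl
  ... | false = ∨-zeroʳ _

  deg-clique : ∀ {v} → InV μ ν v → isIndep μ ν v ≡ false → deg μ ν v ≡ n
  deg-clique {v} v∈@(1≤v , v≤n) v-clique = begin
    suc (countᵇ (adj μ ν v) (verts n))
      ≡⟨ cong suc (countᵇ-verts-cong n (λ t 1≤t t≤n → adj-clique v∈ (1≤t , t≤n) v-clique)) ⟩
    1 + countᵇ (not ∘ (v ≡ᵇ_)) (verts n)
      ≡⟨ cong (_+ countᵇ (not ∘ (v ≡ᵇ_)) (verts n)) (sym (countᵇ-≡ᵇ-verts n v 1≤v v≤n)) ⟩
    countᵇ (v ≡ᵇ_) (verts n) + countᵇ (not ∘ (v ≡ᵇ_)) (verts n)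
      ≡⟨ countᵇ-+-countᵇ-not (v ≡ᵇ_) (verts n) ⟩
    length (verts n)
      ≡⟨ length-verts n ⟩
    n ∎
    where open ≡-Reasoning

  deg-indep : ∀ {v} → InV μ ν v → isIndep μ ν v ≡ true → deg μ ν v + width v ≡ suc n
  deg-indep {v} v∈@(1≤v , _) v-indep = cong suc (begin
    countᵇ (adj μ ν v) (verts n) + width v
      ≡⟨ cong₂ _+_ (countᵇ-verts-cong n (λ t 1≤t t≤n → adj-indep v∈ (1≤t , t≤n) v-indep))
                   (sym (countᵇ-sameComp {v} 1≤v v-indep)) ⟩
    countᵇ (not ∘ sameComp μ ν v) (verts n) + countᵇ (sameComp μ ν v) (verts n)
      ≡⟨ +-comm (countᵇ (not ∘ sameComp μ ν v) (verts n)) _ ⟩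
    countᵇ (sameComp μ ν v) (verts n) + countᵇ (not ∘ sameComp μ ν v) (verts n)
      ≡⟨ countᵇ-+-countᵇ-not (sameComp μ ν v) (verts n) ⟩
    length (verts n)
      ≡⟨ length-verts n ⟩
    n ∎)
    where open ≡-Reasoning

module _ where
  open ℤ.≤-Reasoning

  private
    cancel : ∀ (z a c : ℤ) → ((z ℤ.+ a) ℤ.+ c) ℤ.- a ≡ z ℤ.+ c
    cancel = solve-∀

    add-sub : ∀ (b a : ℤ) → (b ℤ.+ a) ℤ.- a ≡ b
    add-sub = solve-∀

  pos-add-sub : ∀ b a → + (b + a) ℤ.- + a ≡ + b
  pos-add-sub b a = trans (cong (ℤ._- + a) (ℤ.pos-+ b a)) (add-sub (+ b) (+ a))

  +-lower-bound : ∀ z a b c d → + b ℤ.≤ z ℤ.+ + a → d + a ≤ b + c → + d ℤ.≤ z ℤ.+ + c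
  +-lower-bound z a b c d b≤z+a d+a≤b+c = begin
    + d                               ≡⟨ pos-add-sub d a ⟨
    + (d + a) ℤ.- + a                 ≤⟨ ℤ.+-monoˡ-≤ (ℤ.- + a) (ℤ.+≤+ d+a≤b+c) ⟩
    + (b + c) ℤ.- + a                 ≡⟨ cong (ℤ._- + a) (ℤ.pos-+ b c) ⟩
    (+ b ℤ.+ + c) ℤ.- + a             ≤⟨ ℤ.+-monoˡ-≤ (ℤ.- + a) (ℤ.+-monoˡ-≤ (+ c) b≤z+a) ⟩
    ((z ℤ.+ + a) ℤ.+ + c) ℤ.- + a     ≡⟨ cancel z (+ a) (+ c) ⟩
    z ℤ.+ + c                         ∎

  +-upper-bound : ∀ z a b c d → z ℤ.+ + a ℤ.< + b → c + b ≤ d + a → z ℤ.+ + c ℤ.< + d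
  +-upper-bound z a b c d z+a<b c+b≤d+a = begin-strict
    z ℤ.+ + c                         ≡⟨ cancel z (+ a) (+ c) ⟨
    ((z ℤ.+ + a) ℤ.+ + c) ℤ.- + a     <⟨ ℤ.+-monoˡ-< (ℤ.- + a) (ℤ.+-monoˡ-< (+ c) z+a<b) ⟩
    (+ b ℤ.+ + c) ℤ.- + a             ≡⟨ cong (ℤ._- + a) (trans (ℤ.+-comm (+ b) (+ c)) (sym (ℤ.pos-+ c b))) ⟩
    + (c + b) ℤ.- + a                 ≤⟨ ℤ.+-monoˡ-≤ (ℤ.- + a) (ℤ.+≤+ c+b≤d+a) ⟩
    + (d + a) ℤ.- + a                 ≡⟨ pos-add-sub d a ⟩
    + d                               ∎

module Toppling (μ ν : List ℕ) (κ : Config μ ν) (sorted : Sorted μ ν κ) (stable : Stable μ ν κ)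
  (σ : List ℕ) (σ↭ : σ ↭ verts (size μ ν))
  (bounds : ∀ i → InV μ ν i → (+ 0 ℤ.≤ uStat μ ν κ σ i) × (uStat μ ν κ σ i ℤ.< + wStat σ i)) where

  open Graph μ ν

  σ-inV : All (InV μ ν) σ
  σ-inV = All-resp-↭ (↭-sym σ↭) (All-verts n)

  occurrences-σ : ∀ {v} → InV μ ν v → occurrences v σ ≡ 1
  occurrences-σ {v} (1≤v , v≤n) = trans (countᵇ-↭ _ σ↭) (occurrences-verts n v 1≤v v≤n)

  length-σ : length σ ≡ n
  length-σ = trans (↭-length σ↭) (length-verts n)

  prefix-inV : ∀ P R → σ ≡ P ++ R → All (InV μ ν) P
  prefix-inV P R eq = proj₁ (++⁻ P (subst (All (InV μ ν)) eq σ-inV))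

  suffix-inV : ∀ P R → σ ≡ P ++ R → All (InV μ ν) R
  suffix-inV P R eq = proj₂ (++⁻ P (subst (All (InV μ ν)) eq σ-inV))

  occurrences-split : ∀ P R {v} → σ ≡ P ++ R → InV μ ν v → occurrences v P + occurrences v R ≡ 1
  occurrences-split P R eq v∈ = trans (sym (countᵇ-++ _ P R)) (trans (cong (countᵇ _) (sym eq)) (occurrences-σ v∈))

  ∉-split : ∀ P x R → σ ≡ P ++ x ∷ R → x ∉ P × x ∉ R
  ∉-split P x R eq with occurrences-split P (x ∷ R) eq (All.head (suffix-inV P (x ∷ R) eq))
  ... | total rewrite ≡ᵇ-refl x with occurrences x P | occurrences x R | total
  ... | zero | zero | _ = refl , refl
  ... | zero | suc _ | ()
  ... | suc k | _ | e = case trans (sym (+-suc k _)) (suc-injective e) of λ ()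

  untoppled⇒in-suffix : ∀ P R {y} → σ ≡ P ++ R → InV μ ν y → y ∉ P → ¬ y ∉ R
  untoppled⇒in-suffix P R eq y∈ y∉P y∉R with occurrences-split P R eq y∈
  ... | total rewrite y∉P | y∉R = case total of λ ()

  toppled-once : ∀ P R {t} → σ ≡ P ++ R → InV μ ν t → ¬ t ∉ P → occurrences t P ≡ 1 × t ∉ R
  toppled-once P R {t} eq t∈ t∈P = split (occurrences t P) (occurrences t R) (occurrences-split P R eq t∈) t∈P
    where
    split : ∀ a b → a + b ≡ 1 → a ≢ 0 → a ≡ 1 × b ≡ 0
    split zero _ _ a≢0 = ⊥-elim (a≢0 refl)
    split (suc zero) zero _ _ = refl , refl

  config : List ℕ → Config μ ν
  config P = foldl (topple μ ν) (toppleSink μ ν κ) P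

  config-snoc : ∀ P x → config (P ++ x ∷ []) ≡ topple μ ν (config P) x
  config-snoc P x = foldl-∷ʳ (topple μ ν) (toppleSink μ ν κ) x P

  private
    adj-irrefl : ∀ v → adj μ ν v v ≡ false
    adj-irrefl v rewrite ≡ᵇ-refl v = trans (cong (inVᵇ μ ν v ∧_) (∧-zeroʳ _)) (∧-zeroʳ _)

    topple-self : ∀ c v → topple μ ν c v v ≡ c v ℤ.- + deg μ ν v
    topple-self c v rewrite ≡ᵇ-refl v = refl

    topple-other : ∀ c x v → (v ≡ᵇ x) ≡ false → topple μ ν c x v ≡ (if adj μ ν v x then c v ℤ.+ 1ℤ else c v)
    topple-other c x v e rewrite e = refl

    countᵇ-∷-true : ∀ p x xs → p x ≡ true → countᵇ p (x ∷ xs) ≡ suc (countᵇ p xs)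
    countᵇ-∷-true p x xs e rewrite e = refl

    countᵇ-∷-false : ∀ p x xs → p x ≡ false → countᵇ p (x ∷ xs) ≡ countᵇ p xs
    countᵇ-∷-false p x xs e rewrite e = refl

  foldl-topple : ∀ c Q v → foldl (topple μ ν) c Q v
    ≡ (c v ℤ.+ + countᵇ (adj μ ν v) Q) ℤ.- (+ deg μ ν v ℤ.* + occurrences v Q)
  foldl-topple c [] v = no-topplings (c v) (+ deg μ ν v)
    where
    no-topplings : ∀ (a d : ℤ) → a ≡ (a ℤ.+ 0ℤ) ℤ.- (d ℤ.* 0ℤ)
    no-topplings = solve-∀
  foldl-topple c (x ∷ Q) v with v ≟ x
  ... | yes refl = begin
    foldl (topple μ ν) (topple μ ν c x) Q x                   ≡⟨ foldl-topple (topple μ ν c x) Q x ⟩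
    (topple μ ν c x x ℤ.+ + A) ℤ.- (+ d ℤ.* + k)              ≡⟨ cong (λ z → (z ℤ.+ + A) ℤ.- (+ d ℤ.* + k)) (topple-self c x) ⟩
    ((c x ℤ.- + d) ℤ.+ + A) ℤ.- (+ d ℤ.* + k)                 ≡⟨ rearrange (c x) (+ d) (+ A) (+ k) ⟩
    (c x ℤ.+ + A) ℤ.- (+ d ℤ.* (1ℤ ℤ.+ + k))                  ≡⟨ cong₂ (λ a k → (c x ℤ.+ + a) ℤ.- (+ d ℤ.* k))
                                                                    (sym (countᵇ-∷-false (adj μ ν x) x Q (adj-irrefl x)))
                                                                    (trans (sym (ℤ.pos-+ 1 k)) (cong +_ (sym (countᵇ-∷-true (_≡ᵇ x) x Q (≡ᵇ-refl x))))) ⟩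
    (c x ℤ.+ + countᵇ (adj μ ν x) (x ∷ Q)) ℤ.- (+ d ℤ.* + occurrences x (x ∷ Q)) ∎
    where
    open ≡-Reasoning
    A = countᵇ (adj μ ν x) Q
    k = occurrences x Q
    d = deg μ ν x
    rearrange : ∀ (a d A k : ℤ) → ((a ℤ.- d) ℤ.+ A) ℤ.- (d ℤ.* k) ≡ (a ℤ.+ A) ℤ.- (d ℤ.* (1ℤ ℤ.+ k))
    rearrange = solve-∀
  ... | no v≢x = trans (foldl-topple (topple μ ν c x) Q v)
    (trans (cong (λ z → (z ℤ.+ + countᵇ (adj μ ν v) Q) ℤ.- (+ deg μ ν v ℤ.* + occurrences v Q)) (topple-other c x v e))
    (trans (neighbour (adj μ ν v x) refl)
           (cong (λ k → (c v ℤ.+ + countᵇ (adj μ ν v) (x ∷ Q)) ℤ.- (+ deg μ ν v ℤ.* + k))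
                 (sym (countᵇ-∷-false (_≡ᵇ v) x Q (trans (≡ᵇ-sym x v) e))))))
    where
    e : (v ≡ᵇ x) ≡ false
    e = ≡ᵇ-false v≢x
    neighbour : ∀ b → adj μ ν v x ≡ b →
      ((if b then c v ℤ.+ 1ℤ else c v) ℤ.+ + countᵇ (adj μ ν v) Q) ℤ.- (+ deg μ ν v ℤ.* + occurrences v Q)
      ≡ (c v ℤ.+ + countᵇ (adj μ ν v) (x ∷ Q)) ℤ.- (+ deg μ ν v ℤ.* + occurrences v Q)
    neighbour true a = cong (ℤ._- (+ deg μ ν v ℤ.* + occurrences v Q))
      (trans (ℤ.+-assoc (c v) 1ℤ _)
             (cong (λ k → c v ℤ.+ k) (trans (sym (ℤ.pos-+ 1 _)) (cong +_ (sym (countᵇ-∷-true (adj μ ν v) x Q a))))))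
    neighbour false a =
      cong (λ k → (c v ℤ.+ + k) ℤ.- (+ deg μ ν v ℤ.* + occurrences v Q)) (sym (countᵇ-∷-false (adj μ ν v) x Q a))

  toppleSink-inV : ∀ {v} → InV μ ν v → toppleSink μ ν κ v ≡ κ v ℤ.+ 1ℤ
  toppleSink-inV v∈ rewrite inVᵇ-true v∈ = refl

  config-value : ∀ P {v} → InV μ ν v →
    config P v ≡ (κ v ℤ.+ + suc (countᵇ (adj μ ν v) P)) ℤ.- (+ deg μ ν v ℤ.* + occurrences v P)
  config-value P {v} v∈ = begin
    config P v                                                      ≡⟨ foldl-topple (toppleSink μ ν κ) P v ⟩
    (toppleSink μ ν κ v ℤ.+ + A) ℤ.- D                              ≡⟨ cong (λ z → (z ℤ.+ + A) ℤ.- D) (toppleSink-inV v∈) ⟩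
    ((κ v ℤ.+ 1ℤ) ℤ.+ + A) ℤ.- D                                    ≡⟨ cong (ℤ._- D) (ℤ.+-assoc (κ v) 1ℤ (+ A)) ⟩
    (κ v ℤ.+ (1ℤ ℤ.+ + A)) ℤ.- D                                    ≡⟨ cong (λ z → (κ v ℤ.+ z) ℤ.- D) (sym (ℤ.pos-+ 1 A)) ⟩
    (κ v ℤ.+ + suc A) ℤ.- D                                         ∎
    where
    open ≡-Reasoning
    A = countᵇ (adj μ ν v) P
    D = + deg μ ν v ℤ.* + occurrences v P

  config-untoppled : ∀ P {v} → InV μ ν v → v ∉ P → config P v ≡ κ v ℤ.+ + suc (countᵇ (adj μ ν v) P)
  config-untoppled P {v} v∈ v∉P = trans (config-value P v∈)
    (trans (cong (λ k → (κ v ℤ.+ + suc (countᵇ (adj μ ν v) P)) ℤ.- (+ deg μ ν v ℤ.* + k)) v∉P)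
           (no-loss (κ v ℤ.+ + suc (countᵇ (adj μ ν v) P)) (+ deg μ ν v)))
    where
    no-loss : ∀ (a d : ℤ) → a ℤ.- (d ℤ.* 0ℤ) ≡ a
    no-loss = solve-∀

  config-toppled : ∀ P {v} → InV μ ν v → occurrences v P ≡ 1 →
    config P v ≡ (κ v ℤ.+ + suc (countᵇ (adj μ ν v) P)) ℤ.- + deg μ ν v
  config-toppled P {v} v∈ once = trans (config-value P v∈)
    (trans (cong (λ k → (κ v ℤ.+ + suc (countᵇ (adj μ ν v) P)) ℤ.- (+ deg μ ν v ℤ.* + k)) once)
           (cong (λ d → (κ v ℤ.+ + suc (countᵇ (adj μ ν v) P)) ℤ.- d) (ℤ.*-identityʳ (+ deg μ ν v))))

  countᵇ-prefix-≤ : ∀ p P R → σ ≡ P ++ R → countᵇ p P ≤ countᵇ p (verts n)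
  countᵇ-prefix-≤ p P R eq = ≤-trans (m≤m+n (countᵇ p P) (countᵇ p R))
    (≤-reflexive (trans (sym (countᵇ-++ p P R)) (trans (cong (countᵇ p) (sym eq)) (countᵇ-↭ p σ↭))))

  countᵇ-adj-clique : ∀ {y} P → InV μ ν y → isIndep μ ν y ≡ false → All (InV μ ν) P → y ∉ P →
    countᵇ (adj μ ν y) P ≡ length P
  countᵇ-adj-clique {y} P y∈ y-clique P-inV y∉P = begin
    countᵇ (adj μ ν y) P                          ≡⟨ countᵇ-cong (All.map (λ t∈ → adj-clique y∈ t∈ y-clique) P-inV) ⟩
    countᵇ (not ∘ (y ≡ᵇ_)) P                      ≡⟨ cong (_+ countᵇ (not ∘ (y ≡ᵇ_)) P) y∉P′ ⟨
    countᵇ (y ≡ᵇ_) P + countᵇ (not ∘ (y ≡ᵇ_)) P   ≡⟨ countᵇ-+-countᵇ-not (y ≡ᵇ_) P ⟩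
    length P                                      ∎
    where
    open ≡-Reasoning
    y∉P′ : countᵇ (y ≡ᵇ_) P ≡ 0
    y∉P′ = trans (countᵇ-cong (All.map (λ {t} _ → ≡ᵇ-sym y t) P-inV)) y∉P

  countᵇ-adj-indep : ∀ {y} P → InV μ ν y → isIndep μ ν y ≡ true → All (InV μ ν) P →
    countᵇ (adj μ ν y) P + countᵇ (sameComp μ ν y) P ≡ length P
  countᵇ-adj-indep {y} P y∈ y-indep P-inV =
    trans (cong (_+ countᵇ (sameComp μ ν y) P) (countᵇ-cong (All.map (λ t∈ → adj-indep y∈ t∈ y-indep) P-inV)))
          (trans (+-comm _ (countᵇ (sameComp μ ν y) P)) (countᵇ-+-countᵇ-not (sameComp μ ν y) P))

  posOf-++ : ∀ A i Z → i ∉ A → posOf (A ++ i ∷ Z) i ≡ suc (length A)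
  posOf-++ [] i Z _ rewrite ≡ᵇ-refl i = refl
  posOf-++ (x ∷ A) i Z i∉ with x ≡ᵇ i
  ... | false = cong suc (posOf-++ A i Z i∉)

  κtilde-clique : ∀ {v} → isIndep μ ν v ≡ false → κtilde μ ν κ v ≡ κ v ℤ.+ + 0
  κtilde-clique {v} e rewrite e = sym (ℤ.+-identityʳ (κ v))

  κtilde-indep : ∀ {v} → 1 ≤ v → isIndep μ ν v ≡ true → κtilde μ ν κ v ≡ κ v ℤ.+ + offset v
  κtilde-indep {v} 1≤v e = trans (unfold e) (cong (λ z → κ v ℤ.+ z) (width-minus (width v) (offset v) offset≤width))
    where
    offset≤width : offset v ≤ width v
    offset≤width = <⇒≤ (IndepComponent.offset<width (indepComponent v 1≤v e))
    unfold : isIndep μ ν v ≡ true → κtilde μ ν κ v ≡ κ v ℤ.+ (+ width v ℤ.- + (width v ∸ offset v))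
    unfold e rewrite e =
      cong (λ b → κ v ℤ.+ (+ proj₁ (proj₂ b) ℤ.- + (proj₁ (proj₂ b) ∸ proj₂ (proj₂ b)))) (blk-indep v e)
    width-minus : ∀ s o → o ≤ s → + s ℤ.- + (s ∸ o) ≡ + o
    width-minus s o o≤s = trans (cong (λ k → + k ℤ.- + (s ∸ o)) (sym (m+[n∸m]≡n o≤s))) (pos-add-sub o (s ∸ o))

  module _ {i} (i∈ : InV μ ν i) {p o} (pos≡ : posOf σ i ≡ p) (κtilde≡ : κtilde μ ν κ i ≡ κ i ℤ.+ + o) where

    private
      uStat≡ : uStat μ ν κ σ i ≡ (κ i ℤ.+ + (p + o)) ℤ.- + n
      uStat≡ rewrite pos≡ | κtilde≡ =
        cong (ℤ._- + n) (trans (swap-sum (+ p) (κ i) (+ o)) (cong (λ z → κ i ℤ.+ z) (sym (ℤ.pos-+ p o))))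
        where
        swap-sum : ∀ (a b c : ℤ) → a ℤ.+ (b ℤ.+ c) ≡ b ℤ.+ (a ℤ.+ c)
        swap-sum = solve-∀

    bound-u≥0 : + n ℤ.≤ κ i ℤ.+ + (p + o)
    bound-u≥0 = ℤ.0≤i-j⇒j≤i (subst (+ 0 ℤ.≤_) uStat≡ (proj₁ (bounds i i∈)))

    bound-u<w : κ i ℤ.+ + (p + o) ℤ.< + (wStat σ i + n)
    bound-u<w = subst₂ ℤ._<_ (sub-add (κ i ℤ.+ + (p + o)) (+ n)) (sym (ℤ.pos-+ (wStat σ i) n))
             (ℤ.+-monoˡ-< (+ n) (subst (ℤ._< + wStat σ i) uStat≡ (proj₂ (bounds i i∈))))
      where
      sub-add : ∀ (a b : ℤ) → (a ℤ.- b) ℤ.+ b ≡ a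
      sub-add = solve-∀

  UpwardClosed : List ℕ → Set
  UpwardClosed P = ∀ a t → 1 ≤ a → isIndep μ ν a ≡ true → a < t → t ≤ top a → t ∉ P → a ∉ P

  record TopmostUntoppled (P : List ℕ) (y : ℕ) : Set where
    field
      m : ℕ
      y≤m : y ≤ m
      m≤top : m ≤ top y
      m∉P : m ∉ P
      above-toppled : ∀ t → m < t → t ≤ top y → ¬ t ∉ P

  topmost-untoppled : ∀ P {y} → 1 ≤ y → isIndep μ ν y ≡ true → y ∉ P → UpwardClosed P → TopmostUntoppled P y
  topmost-untoppled P {y} 1≤y y-indep y∉P closed = climb (top y ∸ y) y ≤-refl v≤top (m+[n∸m]≡n v≤top) y∉P
    where
    open IndepComponent (indepComponent y 1≤y y-indep)
    climb : ∀ d m → y ≤ m → m ≤ top y → m + d ≡ top y → m ∉ P → TopmostUntoppled P y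
    climb zero m y≤m m≤top m+0≡top m∉P = record
      { m = m ; y≤m = y≤m ; m≤top = m≤top ; m∉P = m∉P
      ; above-toppled = λ t m<t t≤top →
          ⊥-elim (<-irrefl refl (<-≤-trans m<t (≤-trans t≤top (≤-reflexive (trans (sym m+0≡top) (+-identityʳ m)))))) }
    climb (suc d) m y≤m m≤top m+d≡top m∉P with ∉-dec (suc m) P
    ... | inj₁ m+1∉P = climb d (suc m) (m≤n⇒m≤1+n y≤m) (subst (suc m ≤_) m+1+d≡top (m≤m+n (suc m) d)) m+1+d≡top m+1∉P
      where
      m+1+d≡top : suc m + d ≡ top y
      m+1+d≡top = trans (sym (+-suc m d)) m+d≡top
    ... | inj₂ m+1∈P = record { m = m ; y≤m = y≤m ; m≤top = m≤top ; m∉P = m∉P ; above-toppled = above }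
      where
      above : ∀ t → m < t → t ≤ top y → ¬ t ∉ P
      above t m<t t≤top t∉P with m≤n⇒m<n∨m≡n m<t
      ... | inj₂ refl = m+1∈P t∉P
      ... | inj₁ m+1<t = m+1∈P (closed (suc m) t (s≤s z≤n) M.indep m+1<t (subst (t ≤_) (sym M.top≡) t≤top) t∉P)
        where
        module M = SameComponent (member (suc m) (<-≤-trans start<v (m≤n⇒m≤1+n y≤m)) (≤-trans (<⇒≤ m+1<t) t≤top))

  unstableᵇ-true : ∀ {c v} → + deg μ ν v ℤ.≤ c v → unstableᵇ μ ν c v ≡ true
  unstableᵇ-true p = Equivalence.to T-≡ (ℤ.≤⇒≤ᵇ p)

  unstableᵇ-false : ∀ {c v} → c v ℤ.< + deg μ ν v → unstableᵇ μ ν c v ≡ false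
  unstableᵇ-false {c} {v} p with unstableᵇ μ ν c v in e
  ... | true = ⊥-elim (ℤ.<⇒≱ p (ℤ.≤ᵇ⇒≤ (Equivalence.from T-≡ e)))
  ... | false = refl

  -- Vertices of one independent component are interchangeable, except that κ increases upwards.
  module _ {y m} (y∈ : InV μ ν y) (m∈ : InV μ ν m) (y-indep : isIndep μ ν y ≡ true) (y<m : y < m) (m≤top : m ≤ top y) where
    private
      Y = indepComponent y (proj₁ y∈) y-indep
      start<m = <-trans (IndepComponent.start<v Y) y<m
      module M = SameComponent (IndepComponent.member Y m start<m m≤top)

    deg-member : deg μ ν m ≡ deg μ ν y
    deg-member = +-cancelʳ-≡ (width y) _ _
      (trans (cong (λ k → deg μ ν m + k) (sym M.width≡)) (trans (deg-indep m∈ M.indep) (sym (deg-indep y∈ y-indep))))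

    config-member-≤ : ∀ P → All (InV μ ν) P → y ∉ P → m ∉ P → config P y ℤ.≤ config P m
    config-member-≤ P P-inV y∉P m∉P = subst₂ ℤ._≤_ (sym (config-untoppled P y∈ y∉P)) (sym (config-untoppled P m∈ m∉P))
      (subst (λ A → κ y ℤ.+ + suc (countᵇ (adj μ ν y) P) ℤ.≤ κ m ℤ.+ + suc A) (sym same-adj)
        (ℤ.+-monoˡ-≤ (+ suc (countᵇ (adj μ ν y) P)) κy≤κm))
      where
      κy≤κm : κ y ℤ.≤ κ m
      κy≤κm = proj₂ (sorted y m y∈ m∈ y<m (between⇒sameComp (proj₁ y∈) y-indep start<m m≤top)) y-indep
      same-adj : countᵇ (adj μ ν m) P ≡ countᵇ (adj μ ν y) P
      same-adj = countᵇ-cong (All.map (λ {t} t∈ → trans (adj-indep m∈ t∈ M.indep)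
        (trans (cong not (sameComp-member (proj₁ y∈) y-indep start<m m≤top t (proj₁ t∈))) (sym (adj-indep y∈ t∈ y-indep)))) P-inV)

    stable-below : ∀ P → All (InV μ ν) P → y ∉ P → m ∉ P →
      config P m ℤ.< + deg μ ν m → config P y ℤ.< + deg μ ν y
    stable-below P P-inV y∉P m∉P m-stable =
      ℤ.≤-<-trans (config-member-≤ P P-inV y∉P m∉P) (subst (λ d → config P m ℤ.< + d) deg-member m-stable)

  toppled-stable : ∀ P R {v} → σ ≡ P ++ R → InV μ ν v → ¬ v ∉ P → config P v ℤ.< + deg μ ν v
  toppled-stable P R {v} eq v∈ v∈P = begin-strict
    config P v                               ≡⟨ config-toppled P v∈ (proj₁ (toppled-once P R eq v∈ v∈P)) ⟩
    (κ v ℤ.+ + suc A) ℤ.- + deg μ ν v        ≤⟨ ℤ.+-monoˡ-≤ (ℤ.- + deg μ ν v) (ℤ.+-monoʳ-≤ (κ v) (ℤ.+≤+ (s≤s A≤))) ⟩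
    (κ v ℤ.+ + deg μ ν v) ℤ.- + deg μ ν v    ≡⟨ add-sub (κ v) (+ deg μ ν v) ⟩
    κ v                                      <⟨ stable v v∈ ⟩
    + deg μ ν v                              ∎
    where
    open ℤ.≤-Reasoning
    A = countᵇ (adj μ ν v) P
    A≤ : A ≤ countᵇ (adj μ ν v) (verts n)
    A≤ = countᵇ-prefix-≤ (adj μ ν v) P R eq
    add-sub : ∀ (a b : ℤ) → (a ℤ.+ b) ℤ.- b ≡ a
    add-sub = solve-∀

  countᵇ-sameComp-prefix-≤ : ∀ P R {x} → σ ≡ P ++ R → InV μ ν x → isIndep μ ν x ≡ true → x ∉ P →
    UpwardClosed P → countᵇ (sameComp μ ν x) P ≤ top x ∸ x
  countᵇ-sameComp-prefix-≤ P R {x} eq x∈ x-indep x∉P closed = begin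
    countᵇ (sameComp μ ν x) P
      ≡⟨ countᵇ-∧-split (sameComp μ ν x) (x <ᵇ_) P ⟩
    countᵇ (λ t → sameComp μ ν x t ∧ (x <ᵇ t)) P + countᵇ (λ t → sameComp μ ν x t ∧ not (x <ᵇ t)) P
      ≡⟨ cong (λ k → countᵇ (λ t → sameComp μ ν x t ∧ (x <ᵇ t)) P + k) none-below ⟩
    countᵇ (λ t → sameComp μ ν x t ∧ (x <ᵇ t)) P + 0
      ≡⟨ +-identityʳ _ ⟩
    countᵇ (λ t → sameComp μ ν x t ∧ (x <ᵇ t)) P
      ≤⟨ countᵇ-prefix-≤ _ P R eq ⟩
    countᵇ (λ t → sameComp μ ν x t ∧ (x <ᵇ t)) (verts n)
      ≡⟨ countᵇ-sameComp-above (proj₁ x∈) x-indep ⟩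
    top x ∸ x ∎
    where
    open ≤-Reasoning
    X = indepComponent x (proj₁ x∈) x-indep
    untoppled-below : ∀ t → InV μ ν t → (sameComp μ ν x t ∧ not (x <ᵇ t)) ≡ true → t ∉ P
    untoppled-below t t∈ h with ∧-true⁻ {sameComp μ ν x t} h
    ... | same , t≤x with sameComp⇒between (proj₁ x∈) x-indep (proj₁ t∈) same | m≤n⇒m<n∨m≡n (<ᵇ-false⁻ {x} {t} (not-true t≤x))
      where
      not-true : ∀ {b} → not b ≡ true → b ≡ false
      not-true {false} _ = refl
    ... | _ , _ | inj₂ refl = x∉P
    ... | s<t , t≤top | inj₁ t<x = closed t x (proj₁ t∈) T.indep t<x
          (subst (x ≤_) (sym T.top≡) (IndepComponent.v≤top X)) x∉P
      where module T = SameComponent (IndepComponent.member X t s<t t≤top)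
    none-below : countᵇ (λ t → sameComp μ ν x t ∧ not (x <ᵇ t)) P ≡ 0
    none-below = countᵇ≡0-if-∉ _ (prefix-inV P R eq) untoppled-below

  -- This is where u ≥ 0 enters; toppled vertices of the component of x all lie above x.
  next-unstable : ∀ P x R → σ ≡ P ++ x ∷ R → UpwardClosed P → + deg μ ν x ℤ.≤ config P x
  next-unstable P x R eq closed =
    subst (+ deg μ ν x ℤ.≤_) (sym (config-untoppled P x∈ x∉P)) (by-kind (isIndep μ ν x) refl)
    where
    x∈ : InV μ ν x
    x∈ = All.head (suffix-inV P (x ∷ R) eq)
    x∉P : x ∉ P
    x∉P = proj₁ (∉-split P x R eq)
    P-inV : All (InV μ ν) P
    P-inV = prefix-inV P (x ∷ R) eq
    pos≡ : posOf σ x ≡ suc (length P)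
    pos≡ = trans (cong (λ l → posOf l x) eq) (posOf-++ P x R x∉P)
    A = countᵇ (adj μ ν x) P
    by-kind : ∀ b → isIndep μ ν x ≡ b → + deg μ ν x ℤ.≤ κ x ℤ.+ + suc A
    by-kind false x-clique = +-lower-bound (κ x) (suc (length P) + 0) n (suc A) (deg μ ν x)
      (bound-u≥0 x∈ pos≡ (κtilde-clique x-clique))
      (≤-reflexive (cong₂ _+_ (deg-clique x∈ x-clique)
        (trans (+-identityʳ _) (cong suc (sym (countᵇ-adj-clique P x∈ x-clique P-inV x∉P))))))
    by-kind true x-indep = +-lower-bound (κ x) (suc (length P) + offset x) n (suc A) (deg μ ν x)
      (bound-u≥0 x∈ pos≡ (κtilde-indep (proj₁ x∈) x-indep)) (begin
        deg μ ν x + (suc (length P) + offset x)   ≡⟨ cong (λ l → deg μ ν x + (suc l + offset x)) (sym (countᵇ-adj-indep P x∈ x-indep P-inV)) ⟩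
        deg μ ν x + (suc (A + C) + offset x)      ≤⟨ +-monoʳ-≤ (deg μ ν x) (+-monoˡ-≤ (offset x) (s≤s (+-monoʳ-≤ A C≤B))) ⟩
        deg μ ν x + (suc (A + B) + offset x)      ≡⟨ rearrange (deg μ ν x) A B (offset x) ⟩
        (deg μ ν x + suc (B + offset x)) + A      ≡⟨ cong (λ w → (deg μ ν x + w) + A) (above+offset (proj₁ x∈) x-indep) ⟩
        (deg μ ν x + width x) + A                 ≡⟨ cong (_+ A) (deg-indep x∈ x-indep) ⟩
        suc n + A                                 ≡⟨ +-suc n A ⟨
        n + suc A                                 ∎)
      where
      open ≤-Reasoning
      C = countᵇ (sameComp μ ν x) P
      B = top x ∸ x
      C≤B : C ≤ B
      C≤B = countᵇ-sameComp-prefix-≤ P (x ∷ R) eq x∈ x-indep x∉P closed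
      rearrange : ∀ d a b o → d + (suc (a + b) + o) ≡ (d + suc (b + o)) + a
      rearrange = ℕ-Solver.solve-∀

  -- The vertex after which the current scan started: the last toppled vertex, or the sink 0.
  lastOr0 : List ℕ → ℕ
  lastOr0 [] = 0
  lastOr0 (x ∷ []) = x
  lastOr0 (_ ∷ y ∷ l) = lastOr0 (y ∷ l)

  lastOr0-snoc : ∀ P x → lastOr0 (P ++ x ∷ []) ≡ x
  lastOr0-snoc [] x = refl
  lastOr0-snoc (_ ∷ []) x = refl
  lastOr0-snoc (_ ∷ q ∷ P) x = lastOr0-snoc (q ∷ P) x

  0∷-init : ∀ P → Σ[ A ∈ List ℕ ] 0 ∷ P ≡ A ++ lastOr0 P ∷ []
  0∷-init [] = [] , refl
  0∷-init (x ∷ []) = 0 ∷ [] , refl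
  0∷-init (x ∷ y ∷ P) with 0∷-init (y ∷ P)
  ... | 0 ∷ A , eq = 0 ∷ x ∷ A , cong (λ l → 0 ∷ x ∷ l) (∷-injectiveʳ eq)

  lastOr0-toppled : ∀ P → P ≡ [] ⊎ ¬ lastOr0 P ∉ P
  lastOr0-toppled [] = inj₁ refl
  lastOr0-toppled (x ∷ []) = inj₂ (λ h → case trans (sym (occurrences-∷-self x [])) h of λ ())
  lastOr0-toppled (x ∷ y ∷ P) with lastOr0-toppled (y ∷ P)
  ... | inj₂ last∈ = inj₂ (λ last∉ → last∈ (proj₂ (∉-∷⁻ {lastOr0 (y ∷ P)} {x} (y ∷ P) last∉)))

  wStat-≤ : ∀ P r Y y Z → σ ≡ P ++ r ∷ Y ++ y ∷ Z → InV μ ν y → ScanBetween (lastOr0 P) r y →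
    wStat σ y ≤ suc (length Y)
  wStat-≤ P r Y y Z eq y∈ scan = subst (_≤ suc (length Y)) (cong (λ l → wRuns l y) (sym 0σ≡)) bound
    where
    A = proj₁ (0∷-init P)
    a = lastOr0 P
    0σ≡ : 0 ∷ σ ≡ A ++ a ∷ r ∷ Y ++ y ∷ Z
    0σ≡ = trans (cong (0 ∷_) eq) (trans (cong (_++ r ∷ Y ++ y ∷ Z) (proj₂ (0∷-init P))) (++-assoc A (a ∷ []) (r ∷ Y ++ y ∷ Z)))
    y∉PrY : y ∉ (P ++ r ∷ Y)
    y∉PrY = proj₁ (∉-split (P ++ r ∷ Y) y Z (trans eq (sym (++-assoc P (r ∷ Y) (y ∷ Z)))))
    y∉rY : y ∉ (r ∷ Y)
    y∉rY = proj₂ (∉-++⁻ P (r ∷ Y) y∉PrY)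
    y∉Aa : y ∉ (A ++ a ∷ [])
    y∉Aa = subst (y ∉_) (proj₂ (0∷-init P)) (∉-∷ {y} {0} P (λ 0≡y → case subst (1 ≤_) (sym 0≡y) (proj₁ y∈) of λ ()) (proj₁ (∉-++⁻ P (r ∷ Y) y∉PrY)))
    bound : wRuns (A ++ a ∷ r ∷ Y ++ y ∷ Z) y ≤ suc (length Y)
    bound = wRuns-≤-after-scan A a r Y y Z
      (∉⇒All≢ A (proj₁ (∉-++⁻ A (a ∷ []) y∉Aa)))
      (proj₁ (∉-∷⁻ {y} {a} [] (proj₂ (∉-++⁻ A (a ∷ []) y∉Aa))))
      (proj₁ (∉-∷⁻ {y} {r} Y y∉rY))
      (∉⇒All≢ Y (proj₂ (∉-∷⁻ {y} {r} Y y∉rY)))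
      scan

  private
    module Scanned (P : List ℕ) (r : ℕ) (Y : List ℕ) {y} (Z : List ℕ) (eq : σ ≡ P ++ r ∷ Y ++ y ∷ Z)
                   (y∈ : InV μ ν y) (scan : ScanBetween (lastOr0 P) r y) where
      y∉PrY : y ∉ (P ++ r ∷ Y)
      y∉PrY = proj₁ (∉-split (P ++ r ∷ Y) y Z (trans eq (sym (++-assoc P (r ∷ Y) (y ∷ Z)))))
      y∉P : y ∉ P
      y∉P = proj₁ (∉-++⁻ P (r ∷ Y) y∉PrY)
      P-inV : All (InV μ ν) P
      P-inV = prefix-inV P (r ∷ Y ++ y ∷ Z) eq
      p : ℕ
      p = suc (length P + suc (length Y))
      pos≡ : posOf σ y ≡ p
      pos≡ = trans (cong (λ l → posOf l y) (trans eq (sym (++-assoc P (r ∷ Y) (y ∷ Z)))))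
                   (trans (posOf-++ (P ++ r ∷ Y) y Z y∉PrY) (cong suc (length-++ P)))
      A : ℕ
      A = countᵇ (adj μ ν y) P
      w-bound : suc A + (wStat σ y + n) ≤ suc A + (suc (length Y) + n)
      w-bound = +-monoʳ-≤ (suc A) (+-monoˡ-≤ n (wStat-≤ P r Y y Z eq y∈ scan))
      stable-if : ∀ {o} → κtilde μ ν κ y ≡ κ y ℤ.+ + o → suc A + (wStat σ y + n) ≤ deg μ ν y + (p + o) →
        config P y ℤ.< + deg μ ν y
      stable-if {o} κtilde≡ ineq = subst (ℤ._< + deg μ ν y) (sym (config-untoppled P y∈ y∉P))
        (+-upper-bound (κ y) (p + o) (wStat σ y + n) (suc A) (deg μ ν y) (bound-u<w y∈ pos≡ κtilde≡) ineq)

  -- This is where u < w enters: the scan bounds w(y) by the distance from r to y in σ.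
  scanned-stable-clique : ∀ P r Y {y} Z → σ ≡ P ++ r ∷ Y ++ y ∷ Z → InV μ ν y → ScanBetween (lastOr0 P) r y →
    isIndep μ ν y ≡ false → config P y ℤ.< + deg μ ν y
  scanned-stable-clique P r Y {y} Z eq y∈ scan y-clique = stable-if (κtilde-clique y-clique) (begin
    suc A + (wStat σ y + n)               ≤⟨ w-bound ⟩
    suc A + (suc (length Y) + n)          ≡⟨ cong (λ a → suc a + (suc (length Y) + n)) (countᵇ-adj-clique P y∈ y-clique P-inV y∉P) ⟩
    suc (length P) + (suc (length Y) + n) ≡⟨ rearrange (length P) (length Y) n ⟩
    n + (p + 0)                           ≡⟨ cong (_+ (p + 0)) (deg-clique y∈ y-clique) ⟨
    deg μ ν y + (p + 0)                   ∎)
    where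
    open Scanned P r Y Z eq y∈ scan
    open ≤-Reasoning
    rearrange : ∀ l m n → suc l + (suc m + n) ≡ n + (suc (l + suc m) + 0)
    rearrange = ℕ-Solver.solve-∀

  scanned-stable-indep : ∀ P r Y {y} Z → σ ≡ P ++ r ∷ Y ++ y ∷ Z → InV μ ν y → ScanBetween (lastOr0 P) r y →
    isIndep μ ν y ≡ true → top y ∸ y ≤ countᵇ (sameComp μ ν y) P → config P y ℤ.< + deg μ ν y
  scanned-stable-indep P r Y {y} Z eq y∈ scan y-indep above = stable-if (κtilde-indep (proj₁ y∈) y-indep) (begin
    suc A + (wStat σ y + n)                                  ≤⟨ w-bound ⟩
    suc A + (suc (length Y) + n)                             ≡⟨ rearrange₁ A (length Y) n ⟩
    suc n + (A + suc (length Y))                             ≡⟨ cong (_+ (A + suc (length Y))) (deg-indep y∈ y-indep) ⟨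
    (deg μ ν y + width y) + (A + suc (length Y))             ≡⟨ cong (λ w → (deg μ ν y + w) + (A + suc (length Y))) (above+offset (proj₁ y∈) y-indep) ⟨
    (deg μ ν y + suc (B + offset y)) + (A + suc (length Y))  ≡⟨ rearrange₂ (deg μ ν y) A B (offset y) (length Y) ⟨
    deg μ ν y + (suc (A + B + suc (length Y)) + offset y)    ≤⟨ +-monoʳ-≤ (deg μ ν y) (+-monoˡ-≤ (offset y) (s≤s (+-monoˡ-≤ (suc (length Y)) (+-monoʳ-≤ A above)))) ⟩
    deg μ ν y + (suc (A + C + suc (length Y)) + offset y)    ≡⟨ cong (λ l → deg μ ν y + (suc (l + suc (length Y)) + offset y)) (countᵇ-adj-indep P y∈ y-indep P-inV) ⟩
    deg μ ν y + (p + offset y)                               ∎)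
    where
    open Scanned P r Y Z eq y∈ scan
    open ≤-Reasoning
    B = top y ∸ y
    C = countᵇ (sameComp μ ν y) P
    rearrange₁ : ∀ a m n → suc a + (suc m + n) ≡ suc n + (a + suc m)
    rearrange₁ = ℕ-Solver.solve-∀
    rearrange₂ : ∀ d a b o m → d + (suc (a + b + suc m) + o) ≡ (d + suc (b + o)) + (a + suc m)
    rearrange₂ = ℕ-Solver.solve-∀

  countᵇ-sameComp-prefix-≥ : ∀ P R {m} → σ ≡ P ++ R → InV μ ν m → isIndep μ ν m ≡ true →
    (∀ t → m < t → t ≤ top m → ¬ t ∉ P) → top m ∸ m ≤ countᵇ (sameComp μ ν m) P
  countᵇ-sameComp-prefix-≥ P R {m} eq m∈ m-indep above-toppled = begin
    top m ∸ m                   ≡⟨ countᵇ-sameComp-above (proj₁ m∈) m-indep ⟨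
    countᵇ q (verts n)          ≡⟨ countᵇ-↭ q σ↭ ⟨
    countᵇ q σ                  ≡⟨ cong (countᵇ q) eq ⟩
    countᵇ q (P ++ R)           ≡⟨ countᵇ-++ q P R ⟩
    countᵇ q P + countᵇ q R     ≡⟨ cong (λ k → countᵇ q P + k) none-in-R ⟩
    countᵇ q P + 0              ≡⟨ +-identityʳ _ ⟩
    countᵇ q P                  ≤⟨ m≤m+n (countᵇ q P) _ ⟩
    countᵇ q P + countᵇ (λ t → sameComp μ ν m t ∧ not (m <ᵇ t)) P  ≡⟨ countᵇ-∧-split (sameComp μ ν m) (m <ᵇ_) P ⟨
    countᵇ (sameComp μ ν m) P   ∎
    where
    open ≤-Reasoning
    q : ℕ → Bool
    q t = sameComp μ ν m t ∧ (m <ᵇ t)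
    toppled : ∀ t → InV μ ν t → q t ≡ true → t ∉ R
    toppled t t∈ h with ∧-true⁻ {sameComp μ ν m t} h
    ... | same , m<t = proj₂ (toppled-once P R eq t∈ (above-toppled t (<ᵇ-true⁻ {m} m<t)
                         (proj₂ (sameComp⇒between (proj₁ m∈) m-indep (proj₁ t∈) same))))
    none-in-R : countᵇ q R ≡ 0
    none-in-R = countᵇ≡0-if-∉ q (suffix-inV P R eq) toppled

  -- The scan also passes the topmost untoppled vertex m above y before reaching r, and every
  -- vertex above m has toppled.
  topmost-stable : ∀ P r R {y} → σ ≡ P ++ r ∷ R → UpwardClosed P → InV μ ν y → isIndep μ ν y ≡ true →
    r ≢ y → ScanBetween (lastOr0 P) r y → (T : TopmostUntoppled P y) →
    config P (TopmostUntoppled.m T) ℤ.< + deg μ ν (TopmostUntoppled.m T)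
  topmost-stable P r R {y} eq closed y∈ y-indep r≢y scan T = located (split-at m R m∈R)
    where
    open TopmostUntoppled T
    open IndepComponent (indepComponent y (proj₁ y∈) y-indep)
    m∈ : InV μ ν m
    m∈ = ≤-trans (proj₁ y∈) y≤m , ≤-trans m≤top (≤-trans top≤sum sum-ν≤n)
    a = lastOr0 P
    no-a : ¬ (y < a × a ≤ m)
    no-a (y<a , a≤m) with lastOr0-toppled P
    ... | inj₁ refl = case y<a of λ ()
    ... | inj₂ a∈P with m≤n⇒m<n∨m≡n a≤m
    ...   | inj₂ a≡m = a∈P (subst (_∉ P) (sym a≡m) m∉P)
    ...   | inj₁ a<m = a∈P (closed a m (≤-trans (s≤s z≤n) y<a) A.indep a<m (subst (m ≤_) (sym A.top≡) m≤top) m∉P)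
      where module A = SameComponent (member a (<-trans start<v y<a) (≤-trans a≤m m≤top))
    no-r : ¬ (y < r × r ≤ m)
    no-r (y<r , r≤m) = excluded scan
      where
      excluded : ScanBetween a r y → ⊥
      excluded (inj₁ (r<y , _)) = <-asym y<r r<y
      excluded (inj₂ (_ , inj₂ r<y)) = <-asym y<r r<y
      excluded (inj₂ (a<r , inj₁ y<a)) = no-a (y<a , ≤-trans (<⇒≤ a<r) r≤m)
    m≢r : m ≢ r
    m≢r m≡r with m≤n⇒m<n∨m≡n y≤m
    ... | inj₁ y<m = no-r (subst (y <_) m≡r y<m , ≤-reflexive (sym m≡r))
    ... | inj₂ y≡m = r≢y (sym (trans y≡m m≡r))
    m∈R : ¬ m ∉ R
    m∈R m∉R = untoppled⇒in-suffix P (r ∷ R) eq m∈ m∉P (∉-∷ {m} {r} R (m≢r ∘ sym) m∉R)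
    module M = SameComponent (member m (<-≤-trans start<v y≤m) m≤top)
    located : Σ[ Ym ∈ List ℕ ] Σ[ Zm ∈ List ℕ ] R ≡ Ym ++ m ∷ Zm × m ∉ Ym → config P m ℤ.< + deg μ ν m
    located (Ym , Zm , Rm≡ , _) = scanned-stable-indep P r Ym Zm (trans eq (cong (λ l → P ++ r ∷ l) Rm≡)) m∈
      (ScanBetween-raise scan y≤m no-a no-r) M.indep
      (countᵇ-sameComp-prefix-≥ P (r ∷ R) eq m∈ M.indep
        (λ t m<t t≤top → above-toppled t m<t (subst (t ≤_) M.top≡ t≤top)))

  -- y is at most as loaded as the topmost untoppled vertex above it, since κ is sorted.
  skipped-stable : ∀ P r R {y} → σ ≡ P ++ r ∷ R → UpwardClosed P → InV μ ν y → ¬ y ∉ R →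
    ScanBetween (lastOr0 P) r y → config P y ℤ.< + deg μ ν y
  skipped-stable P r R {y} eq closed y∈ y∈R scan with split-at y R y∈R
  ... | Y , Z , R≡ , _ = by-kind (isIndep μ ν y) refl
    where
    eqy : σ ≡ P ++ r ∷ Y ++ y ∷ Z
    eqy = trans eq (cong (λ l → P ++ r ∷ l) R≡)
    y∉PrY : y ∉ (P ++ r ∷ Y)
    y∉PrY = proj₁ (∉-split (P ++ r ∷ Y) y Z (trans eqy (sym (++-assoc P (r ∷ Y) (y ∷ Z)))))
    y∉P : y ∉ P
    y∉P = proj₁ (∉-++⁻ P (r ∷ Y) y∉PrY)
    r≢y : r ≢ y
    r≢y = proj₁ (∉-∷⁻ {y} {r} Y (proj₂ (∉-++⁻ P (r ∷ Y) y∉PrY)))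
    below-topmost : isIndep μ ν y ≡ true → (T : TopmostUntoppled P y) → config P y ℤ.< + deg μ ν y
    below-topmost y-indep T = compare (m≤n⇒m<n∨m≡n y≤m)
      where
      open TopmostUntoppled T
      m∈ : InV μ ν m
      m∈ = ≤-trans (proj₁ y∈) y≤m , ≤-trans m≤top (≤-trans (IndepComponent.top≤sum (indepComponent y (proj₁ y∈) y-indep)) sum-ν≤n)
      m-stable : config P m ℤ.< + deg μ ν m
      m-stable = topmost-stable P r R eq closed y∈ y-indep r≢y scan T
      compare : y < m ⊎ y ≡ m → config P y ℤ.< + deg μ ν y
      compare (inj₁ y<m) = stable-below y∈ m∈ y-indep y<m m≤top P (prefix-inV P (r ∷ R) eq) y∉P m∉P m-stable
      compare (inj₂ y≡m) = subst (λ v → config P v ℤ.< + deg μ ν v) (sym y≡m) m-stable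
    by-kind : ∀ b → isIndep μ ν y ≡ b → config P y ℤ.< + deg μ ν y
    by-kind false y-clique = scanned-stable-clique P r Y Z eqy y∈ scan y-clique
    by-kind true y-indep = below-topmost y-indep (topmost-untoppled P (proj₁ y∈) y-indep y∉P closed)

  -- If the next vertex x of σ had an untoppled vertex above it in its independent component, then
  -- x + 1 would be untoppled, scanned before x and hence stable, and so x would be stable too.
  UpwardClosed-snoc : ∀ P x R → σ ≡ P ++ x ∷ R → UpwardClosed P → UpwardClosed (P ++ x ∷ [])
  UpwardClosed-snoc P x R eq closed a t 1≤a a-indep a<t t≤top t∉Px =
    ∉-++ P (x ∷ []) (closed a t 1≤a a-indep a<t t≤top t∉P) (∉-∷ {a} {x} [] x≢a refl)
    where
    t∉P : t ∉ P
    t∉P = proj₁ (∉-++⁻ P (x ∷ []) t∉Px)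
    x∈ : InV μ ν x
    x∈ = All.head (suffix-inV P (x ∷ R) eq)
    x∉P : x ∉ P
    x∉P = proj₁ (∉-split P x R eq)
    x≢a : x ≢ a
    x≢a refl = ℤ.<⇒≱ x-stable (next-unstable P x R eq closed)
      where
      open IndepComponent (indepComponent x 1≤a a-indep)
      z∈ : InV μ ν (suc x)
      z∈ = s≤s z≤n , ≤-trans a<t (≤-trans t≤top (≤-trans top≤sum sum-ν≤n))
      module Z = SameComponent (member (suc x) (<-trans start<v ≤-refl) (≤-trans a<t t≤top))
      z∉P : suc x ∉ P
      z∉P with m≤n⇒m<n∨m≡n a<t
      ... | inj₂ z≡t = subst (_∉ P) (sym z≡t) t∉P
      ... | inj₁ z<t = closed (suc x) t (s≤s z≤n) Z.indep z<t (subst (t ≤_) (sym Z.top≡) t≤top) t∉P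
      z∈R : ¬ suc x ∉ R
      z∈R z∉R = untoppled⇒in-suffix P (x ∷ R) eq z∈ z∉P (∉-∷ {suc x} {x} R (λ x≡z → <-irrefl x≡z ≤-refl) z∉R)
      last≢ : ∀ {v} → v ∉ P → 1 ≤ v → lastOr0 P ≢ v
      last≢ {v} v∉P 1≤v last≡v with lastOr0-toppled P
      ... | inj₁ refl = case subst (1 ≤_) (sym last≡v) 1≤v of λ ()
      ... | inj₂ last∈P = last∈P (subst (_∉ P) (sym last≡v) v∉P)
      z-stable : config P (suc x) ℤ.< + deg μ ν (suc x)
      z-stable = skipped-stable P x R eq closed z∈ z∈R (ScanBetween-suc (last≢ x∉P 1≤a) (last≢ z∉P (s≤s z≤n)))
      x-stable : config P x ℤ.< + deg μ ν x
      x-stable = stable-below x∈ z∈ a-indep ≤-refl (≤-trans a<t t≤top) P (prefix-inV P (x ∷ R) eq) x∉P z∉P z-stable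

  κ-nonneg-offset0 : ∀ {v} → InV μ ν v → κtilde μ ν κ v ≡ κ v ℤ.+ + 0 → + 0 ℤ.≤ κ v
  κ-nonneg-offset0 {v} v∈ κtilde≡ with split-at v σ (λ v∉σ → case trans (sym (occurrences-σ v∈)) v∉σ of λ ())
  ... | Y , Z , σ≡ , v∉Y = subst (+ 0 ℤ.≤_) (ℤ.+-identityʳ (κ v))
    (+-lower-bound (κ v) (p + 0) n 0 0 (bound-u≥0 v∈ pos≡ κtilde≡) (≤-trans (≤-reflexive (+-identityʳ p)) (≤-trans p≤n (≤-reflexive (sym (+-identityʳ n))))))
    where
    p = suc (length Y)
    pos≡ : posOf σ v ≡ p
    pos≡ = trans (cong (λ l → posOf l v) σ≡) (posOf-++ Y v Z v∉Y)
    p≤n : p ≤ n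
    p≤n = subst (p ≤_) (trans (cong length (sym σ≡)) length-σ)
            (subst (p ≤_) (sym (length-++ Y)) (≤-trans (≤-reflexive (+-comm 1 (length Y))) (+-monoʳ-≤ (length Y) (s≤s z≤n))))

  -- In an independent component the bottom vertex has offset 0 and κ increases upwards.
  κ-nonneg : ∀ {v} → InV μ ν v → + 0 ℤ.≤ κ v
  κ-nonneg {v} v∈ = by-kind (isIndep μ ν v) refl
    where
    by-kind : ∀ b → isIndep μ ν v ≡ b → + 0 ℤ.≤ κ v
    by-kind false v-clique = κ-nonneg-offset0 v∈ (κtilde-clique v-clique)
    by-kind true v-indep = from-bottom (m≤n⇒m<n∨m≡n start<v)
      where
      open IndepComponent (indepComponent v (proj₁ v∈) v-indep)
      b = suc (start v)
      module B = SameComponent (member b ≤-refl (≤-trans start<v v≤top))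
      b∈ : InV μ ν b
      b∈ = s≤s z≤n , ≤-trans start<v (proj₂ v∈)
      bottom-nonneg : + 0 ℤ.≤ κ b
      bottom-nonneg = κ-nonneg-offset0 b∈
        (trans (κtilde-indep (s≤s z≤n) B.indep) (cong (λ o → κ b ℤ.+ + o) (trans B.offset≡ (n∸n≡0 (start v)))))
      from-bottom : b < v ⊎ b ≡ v → + 0 ℤ.≤ κ v
      from-bottom (inj₂ b≡v) = subst (λ w → + 0 ℤ.≤ κ w) b≡v bottom-nonneg
      from-bottom (inj₁ b<v) = ℤ.≤-trans bottom-nonneg (proj₂ (sorted b v b∈ v∈ b<v same) B.indep)
        where
        same : sameComp μ ν b v ≡ true
        same = between⇒sameComp (s≤s z≤n) B.indep (subst (_< v) (sym B.start≡) start<v) (subst (v ≤_) (sym B.top≡) v≤top)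

  nonNeg-toppleSink : NonNeg μ ν (toppleSink μ ν κ)
  nonNeg-toppleSink v v∈ = subst (+ 0 ℤ.≤_) (sym (toppleSink-inV v∈)) (ℤ.≤-trans (κ-nonneg v∈) (ℤ.i≤i+j (κ v) 1ℤ))

  nonNeg-topple : ∀ c x → NonNeg μ ν c → + deg μ ν x ℤ.≤ c x → NonNeg μ ν (topple μ ν c x)
  nonNeg-topple c x c≥0 x-unstable u u∈ with u ≟ x
  ... | yes refl = subst (+ 0 ℤ.≤_) (sym (topple-self c u)) (ℤ.i≤j⇒0≤j-i x-unstable)
  ... | no u≢x = subst (+ 0 ℤ.≤_) (sym (topple-other c x u (≡ᵇ-false u≢x))) (neighbour (adj μ ν u x))
    where
    neighbour : ∀ b → + 0 ℤ.≤ (if b then c u ℤ.+ 1ℤ else c u)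
    neighbour true = ℤ.≤-trans (c≥0 u u∈) (ℤ.i≤i+j (c u) 1ℤ)
    neighbour false = c≥0 u u∈

  nonNegRun : ∀ P R → σ ≡ P ++ R → UpwardClosed P → NonNeg μ ν (config P) → NonNegRun μ ν (config P) R
  nonNegRun P [] _ _ c≥0 = c≥0
  nonNegRun P (x ∷ R) eq closed c≥0 = c≥0 , subst (λ c → NonNegRun μ ν c R) (config-snoc P x)
    (nonNegRun (P ++ x ∷ []) R (trans eq (sym (++-assoc P (x ∷ []) R))) (UpwardClosed-snoc P x R eq closed)
      (subst (NonNeg μ ν) (sym (config-snoc P x)) (nonNeg-topple (config P) x c≥0 (next-unstable P x R eq closed))))

  -- The pass is about to examine vertex c, and c is either the next vertex r of σ or scanned
  -- strictly between the last toppled vertex and r.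
  InStep : List ℕ → List ℕ → ℕ → Set
  InStep P [] c = ⊤
  InStep P (r ∷ _) c = c ≡ r ⊎ ScanBetween (lastOr0 P) r c

  record PassResult (P R : List ℕ) (c : ℕ) : Set where
    field
      Q R′ : List ℕ
      R≡ : R ≡ Q ++ R′
      pass≡ : pass μ ν (config P) (vertsDown c) ≡ (config (P ++ Q) , Q)
      closed : UpwardClosed (P ++ Q)
      in-step : InStep (P ++ Q) R′ 0
      shrinks : length R′ ≤ length R
      progress : ∀ r R₀ → R ≡ r ∷ R₀ → r ≤ c → length R′ < length R

  private
    pass-unstable : ∀ c i is → unstableᵇ μ ν c i ≡ true →
      pass μ ν c (i ∷ is) ≡ (proj₁ (pass μ ν (topple μ ν c i) is) , i ∷ proj₂ (pass μ ν (topple μ ν c i) is))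
    pass-unstable c i is e rewrite e = refl

    pass-stable : ∀ c i is → unstableᵇ μ ν c i ≡ false → pass μ ν c (i ∷ is) ≡ pass μ ν c is
    pass-stable c i is e rewrite e = refl

  pass-skip : ∀ {P R c} → config P (suc c) ℤ.< + deg μ ν (suc c) → (∀ r R₀ → R ≡ r ∷ R₀ → r ≢ suc c) →
    PassResult P R c → PassResult P R (suc c)
  pass-skip {P} {R} {c} 1+c-stable r≢1+c rest = record
    { Q = Q ; R′ = R′ ; R≡ = R≡
    ; pass≡ = trans (pass-stable (config P) (suc c) (vertsDown c) (unstableᵇ-false {config P} {suc c} 1+c-stable)) pass≡
    ; closed = closed ; in-step = in-step ; shrinks = shrinks
    ; progress = λ r R₀ R≡r∷ r≤1+c → progress r R₀ R≡r∷ (r≤c (r≢1+c r R₀ R≡r∷) r≤1+c)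
    }
    where
    open PassResult rest
    r≤c : ∀ {r} → r ≢ suc c → r ≤ suc c → r ≤ c
    r≤c r≢1+c r≤1+c with m≤n⇒m<n∨m≡n r≤1+c
    ... | inj₁ r<1+c = ℕ.s≤s⁻¹ r<1+c
    ... | inj₂ r≡1+c = ⊥-elim (r≢1+c r≡1+c)

  pass-topple : ∀ {P r R₀ c} → + deg μ ν (suc c) ℤ.≤ config P (suc c) → suc c ≡ r →
    PassResult (P ++ r ∷ []) R₀ c → PassResult P (r ∷ R₀) (suc c)
  pass-topple {P} {r} {R₀} {c} 1+c-unstable refl rest = record
    { Q = r ∷ Q ; R′ = R′ ; R≡ = cong (r ∷_) R≡
    ; pass≡ = trans (pass-unstable (config P) r (vertsDown c) (unstableᵇ-true {config P} {r} 1+c-unstable))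
        (cong (λ w → proj₁ w , r ∷ proj₂ w)
          (trans (cong (λ w → pass μ ν w (vertsDown c)) (sym (config-snoc P r)))
                 (trans pass≡ (cong (λ l → config l , Q) ++-∷ʳ-assoc))))
    ; closed = subst UpwardClosed ++-∷ʳ-assoc closed
    ; in-step = subst (λ l → InStep l R′ 0) ++-∷ʳ-assoc in-step
    ; shrinks = ≤-trans shrinks (n≤1+n _)
    ; progress = λ _ _ _ _ → s≤s shrinks
    }
    where
    open PassResult rest
    ++-∷ʳ-assoc : (P ++ r ∷ []) ++ Q ≡ P ++ r ∷ Q
    ++-∷ʳ-assoc = ++-assoc P (r ∷ []) Q

  in-step-after-topple : ∀ P r R {c} → σ ≡ P ++ r ∷ R → suc c ≡ r → InStep (P ++ r ∷ []) R c
  in-step-after-topple P r [] _ _ = tt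
  in-step-after-topple P r (r₁ ∷ R₁) {c} eq 1+c≡r =
    subst (λ a → c ≡ r₁ ⊎ ScanBetween a r₁ c) (sym (trans (lastOr0-snoc P r) (sym 1+c≡r)))
      (ScanBetween-restart c (λ r₁≡1+c → r≢r₁ (trans (sym 1+c≡r) (sym r₁≡1+c))))
    where
    r₁∉Pr : r₁ ∉ (P ++ r ∷ [])
    r₁∉Pr = proj₁ (∉-split (P ++ r ∷ []) r₁ R₁ (trans eq (sym (++-assoc P (r ∷ []) (r₁ ∷ R₁)))))
    r≢r₁ : r ≢ r₁
    r≢r₁ = proj₁ (∉-∷⁻ {r₁} {r} [] (proj₂ (∉-++⁻ P (r ∷ []) r₁∉Pr)))

  scanned-vertex-stable : ∀ P r R {v} → σ ≡ P ++ r ∷ R → UpwardClosed P → InV μ ν v →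
    ScanBetween (lastOr0 P) r v → config P v ℤ.< + deg μ ν v
  scanned-vertex-stable P r R {v} eq closed v∈ scan with ∉-dec v P
  ... | inj₂ v∈P = toppled-stable P (r ∷ R) eq v∈ v∈P
  ... | inj₁ v∉P = skipped-stable P r R eq closed v∈ v∈R scan
    where
    v∈R : ¬ v ∉ R
    v∈R v∉R = untoppled⇒in-suffix P (r ∷ R) eq v∈ v∉P (∉-∷ {v} {r} R (ScanBetween-≢ scan ∘ sym) v∉R)

  pass-simulation : ∀ c → c ≤ n → ∀ P R → σ ≡ P ++ R → UpwardClosed P → InStep P R c → PassResult P R c
  pass-simulation zero _ P R eq closed in-step = record
    { Q = [] ; R′ = R ; R≡ = refl
    ; pass≡ = cong (λ l → config l , []) (sym (++-identityʳ P))
    ; closed = subst UpwardClosed (sym (++-identityʳ P)) closed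
    ; in-step = subst (λ l → InStep l R 0) (sym (++-identityʳ P)) in-step
    ; shrinks = ≤-refl
    ; progress = λ r R₀ R≡ r≤0 → case ≤-trans (proj₁ (All.head (subst (All (InV μ ν)) R≡ (suffix-inV P R eq)))) r≤0 of λ ()
    }
  pass-simulation (suc c) 1+c≤n P [] eq closed _ =
    pass-skip (toppled-stable P [] eq 1+c∈ (λ 1+c∉P → untoppled⇒in-suffix P [] eq 1+c∈ 1+c∉P refl)) (λ _ _ ())
      (pass-simulation c (≤-trans (n≤1+n c) 1+c≤n) P [] eq closed tt)
    where
    1+c∈ : InV μ ν (suc c)
    1+c∈ = s≤s z≤n , 1+c≤n
  pass-simulation (suc c) 1+c≤n P (r ∷ R) eq closed (inj₁ 1+c≡r) =
    pass-topple (subst (λ v → + deg μ ν v ℤ.≤ config P v) (sym 1+c≡r) (next-unstable P r R eq closed)) 1+c≡r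
      (pass-simulation c (≤-trans (n≤1+n c) 1+c≤n) (P ++ r ∷ []) R (trans eq (sym (++-assoc P (r ∷ []) R)))
        (UpwardClosed-snoc P r R eq closed) (in-step-after-topple P r R eq 1+c≡r))
  pass-simulation (suc c) 1+c≤n P (r ∷ R) eq closed (inj₂ scan) =
    pass-skip (scanned-vertex-stable P r R eq closed (s≤s z≤n , 1+c≤n) scan)
      (λ { _ _ refl r≡1+c → ScanBetween-≢ scan (sym r≡1+c) })
      (pass-simulation c (≤-trans (n≤1+n c) 1+c≤n) P (r ∷ R) eq closed (ScanBetween-step scan))

  in-step-restart : ∀ P R → All (InV μ ν) R → InStep P R 0 → InStep P R n
  in-step-restart P [] _ _ = tt
  in-step-restart P (r ∷ R) ((1≤r , _) ∷ _) (inj₁ 0≡r) = case subst (1 ≤_) (sym 0≡r) 1≤r of λ ()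
  in-step-restart P (r ∷ R) _ (inj₂ (inj₁ (() , _)))
  in-step-restart P (r ∷ R) _ (inj₂ (inj₂ (_ , inj₂ ())))
  in-step-restart P (r ∷ R) ((_ , r≤n) ∷ _) (inj₂ (inj₂ (a<r , inj₁ _))) with m≤n⇒m<n∨m≡n r≤n
  ... | inj₁ r<n = inj₂ (inj₂ (a<r , inj₂ r<n))
  ... | inj₂ r≡n = inj₁ (sym r≡n)

  allToppled-σ : allToppledᵇ μ ν σ ≡ true
  allToppled-σ = all-true _ (All.map (λ v∈ → toppled v∈) (All-verts n))
    where
    toppled : ∀ {v} → InV μ ν v → memᵇ v σ ≡ true
    toppled {v} v∈ with memᵇ v σ in e
    ... | true = refl
    ... | false = case trans (sym (occurrences-σ v∈)) (memᵇ⇒∉ σ e) of λ ()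

  allToppled-prefix : ∀ P {r} → InV μ ν r → r ∉ P → allToppledᵇ μ ν P ≡ false
  allToppled-prefix P {r} r∈@(1≤r , r≤n) r∉P with allToppledᵇ μ ν P in e
  ... | false = refl
  ... | true = case trans (sym (all-true⁻ _ (verts n) e r∈verts)) (∉⇒memᵇ P r∉P) of λ ()
    where
    r∈verts : ¬ r ∉ verts n
    r∈verts r∉ = case trans (sym (occurrences-verts n r 1≤r r≤n)) r∉ of λ ()

  loop-simulation : ∀ k P R → length R ≤ k → σ ≡ P ++ R → UpwardClosed P → InStep P R n → Loop μ ν (config P) P σ
  loop-simulation _ P [] _ eq _ _ =
    subst (Loop μ ν (config P) P) (sym σ≡P) (done (subst (λ l → allToppledᵇ μ ν l ≡ true) σ≡P allToppled-σ))
    where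
    σ≡P : σ ≡ P
    σ≡P = trans eq (++-identityʳ P)
  loop-simulation (suc k) P (r ∷ R₀) |R|≤1+k eq closed in-step =
    step (allToppled-prefix P r∈ (proj₁ (∉-split P r R₀ eq)))
      (subst (λ result → Loop μ ν (proj₁ result) (P ++ proj₂ result) σ) (sym O.pass≡)
        (loop-simulation k (P ++ O.Q) O.R′ |R′|≤k eq′ O.closed (in-step-restart _ _ (suffix-inV _ _ eq′) O.in-step)))
    where
    r∈ : InV μ ν r
    r∈ = All.head (suffix-inV P (r ∷ R₀) eq)
    module O = PassResult (pass-simulation n ≤-refl P (r ∷ R₀) eq closed in-step)
    eq′ : σ ≡ (P ++ O.Q) ++ O.R′
    eq′ = trans eq (trans (cong (P ++_) O.R≡) (sym (++-assoc P O.Q O.R′)))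
    |R′|≤k : length O.R′ ≤ k
    |R′|≤k = ℕ.s≤s⁻¹ (≤-trans (O.progress r R₀ refl (proj₂ r∈)) |R|≤1+k)

  nothing-toppled : UpwardClosed []
  nothing-toppled _ _ _ _ _ _ _ = refl

  starts-in-step : ∀ R → All (InV μ ν) R → InStep [] R n
  starts-in-step [] _ = tt
  starts-in-step (r ∷ _) ((1≤r , r≤n) ∷ _) with m≤n⇒m<n∨m≡n r≤n
  ... | inj₁ r<n = inj₂ (inj₂ (1≤r , inj₂ r<n))
  ... | inj₂ r≡n = inj₁ (sym r≡n)

  recurrent-and-output : Recurrent μ ν κ × OutputWord μ ν κ σ
  recurrent-and-output =
    (stable , σ , σ↭ , nonNegRun [] σ refl nothing-toppled nonNeg-toppleSink) ,
    loop-simulation (length σ) [] σ ≤-refl refl nothing-toppled (starts-in-step σ σ-inV)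

proposition6p7 : (μ ν : List ℕ) → Composition μ → Composition ν →
    (κ : Config μ ν) → Sorted μ ν κ → Stable μ ν κ →
    (σ : List ℕ) → σ ↭ verts (size μ ν) →
    (∀ i → InV μ ν i → (+ 0 ℤ.≤ uStat μ ν κ σ i) × (uStat μ ν κ σ i ℤ.< + wStat σ i)) →
    Recurrent μ ν κ × OutputWord μ ν κ σ
proposition6p7 μ ν _ _ κ sorted stable σ σ↭ bounds = Toppling.recurrent-and-output μ ν κ sorted stable σ σ↭ bounds
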